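{- Let $(G,w)$ be a vertex-weighted graph. Then $$ X_{(G,w)}[2\mathbf{x}] = \sum_{\substack{\pi \vdash V(G) \\ \text{all } C\in C(\pi) \text{ bipartite}}} 2^{|C(\pi)|}\,\widetilde{m}_{\lambda(\pi)}, $$ where the sum is over set partitions $\pi$ of $V(G)$, $C(\pi)$ is the set of connected components of the graphs $G|_B$ for the blocks $B$ of $\pi$, a graph is bipartite if it has a proper colouring with at most two colours, and $\lambda(\pi)$ is the integer partition whose parts are the total weights $\sum_{v\in B}w(v)$ of the blocks $B$ of $\pi$.
   Context: A vertex-weighted graph $(G,w)$ is a finite graph $G$ with $w: V(G)\to\mathbb{Z}^+$; $X_{(G,w)}=\sum_{\kappa}\prod_{v}x_{\kappa(v)}^{w(v)}$ summed over proper colourings $\kappa:V(G)\to\mathbb{Z}^+$. $\mathbf{x}=x_1+x_2+\cdots$ and $2\mathbf{x}=\mathbf{x}+\mathbf{x}$ in plethystic notation, so $p_n[2\mathbf{x}]=2p_n(\mathbf{x})$. $\widetilde{m}_\lambda=\left(\prod_{i}r_i(\lambda)!\right)m_\lambda$ where $r_i(\lambda)$ is the number of parts of $\lambda$ equal to $i$. -}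

module Defs where

open import Data.Nat using (ℕ; zero; suc; _+_; _*_; _^_; _≤_; _!; _≡ᵇ_)
open import Data.Bool using (Bool; true; false; _∧_; _∨_; not; if_then_else_)
open import Data.Fin using (Fin; zero; suc; _<?_) renaming (_≟_ to _≟ᶠ_)
open import Data.List using (List; []; _∷_; [_]; map; concatMap; length;
  allFin; upTo; lookup; _++_) renaming (filterᵇ to filter)
open import Data.Bool.ListAction using (all; any)
open import Data.Nat.ListAction using (sum; product)
open import Data.Product using (_×_; _,_; proj₁)
open import Relation.Nullary.Decidable using (⌊_⌋)
open import Relation.Binary.PropositionalEquality using (_≡_)

allFuns : {A : Set} → List A → (n : ℕ) → List (Fin n → A)
allFuns xs zero = [ (λ ()) ]
allFuns xs (suc n) =
  concatMap (λ a → map (λ f → λ { zero → a ; (suc i) → f i }) (allFuns xs n)) xs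

bools : List Bool
bools = true ∷ false ∷ []

_==_ : {n : ℕ} → Fin n → Fin n → Bool
i == j = ⌊ i ≟ᶠ j ⌋

-- Vertex-weighted graphs.  Vertices are Fin n; edges are a list of
-- (unordered) pairs, so multi-edges and loops are allowed ("finite graph").

record WGraph : Set where
  field
    n      : ℕ
    edges  : List (Fin n × Fin n)
    weight : Fin n → ℕ

open WGraph public

PositiveWeights : WGraph → Set
PositiveWeights G = (v : Fin (n G)) → 1 ≤ weight G v

adj : (G : WGraph) → Fin (n G) → Fin (n G) → Bool
adj G u v = any (λ { (a , b) → (a == u ∧ b == v) ∨ (a == v ∧ b == u) }) (edges G)

-- Monomials in x₁, x₂, … : an exponent list α = (α₁,…,α_k) means
-- x₁^α₁ ⋯ x_k^α_k (trailing zeros allowed).  A formal power series is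
-- given by its coefficient function on monomials.

-- A colouring κ with values in an alphabet C, where colour c stands for the
-- variable x_{var c}.  Exponent of x_i in ∏_v x_{var(κ v)}^{w v}:
expo : (G : WGraph) {C : Set} {k : ℕ} (var : C → Fin k) →
       (Fin (n G) → C) → Fin k → ℕ
expo G var κ i = sum (map (λ v → if var (κ v) == i then weight G v else 0) (allFin (n G)))

proper : (G : WGraph) {C : Set} (eqC : C → C → Bool) → (Fin (n G) → C) → Bool
proper G eqC κ = all (λ { (a , b) → not (eqC (κ a) (κ b)) }) (edges G)

hasMonomial : (G : WGraph) {C : Set} {k : ℕ} (var : C → Fin k) →
              (Fin (n G) → C) → (Fin k → ℕ) → Bool
hasMonomial G var κ α = all (λ i → expo G var κ i ≡ᵇ α i) (allFin _)

-- Coefficient of x^α in X_{(G,w)} = Σ_κ ∏_v x_{κ(v)}^{w(v)}.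
-- Since w(v) ≥ 1, only colourings with values among the first k = length α
-- colours can contribute to x^α, so we enumerate colourings into Fin k.
X-coeff : WGraph → List ℕ → ℕ
X-coeff G α =
  length (filter (λ κ → proper G _==_ κ ∧ hasMonomial G (λ c → c) κ (lookup α))
                 (allFuns (allFin (length α)) (n G)))

-- Coefficient of x^α in X_{(G,w)}[2x] = X_{(G,w)}(x₁,x₁',x₂,x₂',…)|_{x'=x},
-- i.e. X evaluated on the doubled alphabet 𝐱+𝐱: colours are pairs (i,b),
-- b ∈ {true,false} labelling the two copies, and colour (i,b) stands for x_i.
X[2x]-coeff : WGraph → List ℕ → ℕ
X[2x]-coeff G α =
  length (filter (λ κ → proper G eq2 κ ∧ hasMonomial G proj₁ κ (lookup α))
                 (allFuns (concatMap (λ i → map (i ,_) bools) (allFin (length α))) (n G)))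
  where
    eqB : Bool → Bool → Bool
    eqB true true = true
    eqB false false = true
    eqB _ _ = false
    eq2 : Fin (length α) × Bool → Fin (length α) × Bool → Bool
    eq2 (i , b) (j , c) = (i == j) ∧ eqB b c

-- Integer partitions as multisets (lists up to order) of positive integers.

count : ℕ → List ℕ → ℕ
count x xs = length (filter (λ y → ⌊ Data.Nat._≟_ x y ⌋) xs)

sameMultiset : List ℕ → List ℕ → Bool
sameMultiset xs ys = all (λ x → count x xs ≡ᵇ count x ys) (xs ++ ys)

-- Coefficient of x^α in the monomial symmetric function m_λ:
-- 1 if the nonzero exponents of α form the multiset λ, else 0.
m-coeff : List ℕ → List ℕ → ℕ
m-coeff λ′ α =
  if sameMultiset (filter (λ a → not ⌊ Data.Nat._≟_ a 0 ⌋) α) λ′ then 1 else 0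

multFactorial : List ℕ → ℕ
multFactorial λ′ = product (map (λ i → (count (suc i) λ′) !) (upTo (sum λ′)))

m̃-coeff : List ℕ → List ℕ → ℕ
m̃-coeff λ′ α = multFactorial λ′ * m-coeff λ′ α

-- Set partitions of V(G) = Fin n, as equivalence relations on Fin n.

Rel : ℕ → Set
Rel n = Fin n → Fin n → Bool

isEquivalence : {n : ℕ} → Rel n → Bool
isEquivalence {n} R =
  all (λ u → R u u) (allFin n) ∧
  all (λ u → all (λ v → not (R u v) ∨ R v u) (allFin n)) (allFin n) ∧
  all (λ u → all (λ v → all (λ x → not (R u v ∧ R v x) ∨ R u x) (allFin n)) (allFin n)) (allFin n)

setPartitions : (n : ℕ) → List (Rel n)
setPartitions n = filter isEquivalence (allFuns (allFuns bools n) n)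

classReps : {n : ℕ} → Rel n → List (Fin n)
classReps {n} R =
  filter (λ v → not (any (λ u → ⌊ u <? v ⌋ ∧ R u v) (allFin n))) (allFin n)

blockWeights : (G : WGraph) → Rel (n G) → List ℕ
blockWeights G π =
  map (λ r → sum (map (λ u → if π r u then weight G u else 0) (allFin (n G))))
      (classReps π)

reachIn : (G : WGraph) → (Fin (n G) → Bool) → ℕ → Fin (n G) → Fin (n G) → Bool
reachIn G S zero    u v = S u ∧ (u == v)
reachIn G S (suc k) u v =
  reachIn G S k u v ∨ any (λ x → reachIn G S k u x ∧ S v ∧ adj G x v) (allFin (n G))

sameComponent : (G : WGraph) → Rel (n G) → Rel (n G)
sameComponent G π u v = π u v ∧ reachIn G (π u) (n G) u v

-- C(π): the connected components of the graphs G|_B, B a block of π,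
-- listed by their least vertex
components : (G : WGraph) → Rel (n G) → List (Fin (n G))
components G π = classReps (sameComponent G π)

bipartiteOn : (G : WGraph) → (Fin (n G) → Bool) → Bool
bipartiteOn G C =
  any (λ c → all (λ { (a , b) → not (C a ∧ C b) ∨ not (c a == c b) }) (edges G))
      (allFuns (allFin 2) (n G))

allComponentsBipartite : (G : WGraph) → Rel (n G) → Bool
allComponentsBipartite G π =
  all (λ r → bipartiteOn G (sameComponent G π r)) (components G π)

rhs-coeff : WGraph → List ℕ → ℕ
rhs-coeff G α =
  sum (map (λ π → if allComponentsBipartite G π
                    then 2 ^ length (components G π) * m̃-coeff (blockWeights G π) α
                    else 0)
           (setPartitions (n G)))

module Submission where

-- A colouring from the doubled alphabet is a pair (ℓ , b) of a colouring ℓ by the variables and a label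
-- b : V → Bool, and it is proper iff b separates the ends of every edge lying inside a block of the kernel π
-- of ℓ. Grouping colourings by π: the ℓ with kernel π and monomial x^α are the injective colourings of the
-- blocks of π, counted by m̃_{λ(π)}(α); the admissible b are the proper 2-colourings of the components C(π),
-- of which there are 2^{|C(π)|} if every component is bipartite and none otherwise.

open import Defs
open import Data.Nat using (ℕ; zero; suc; _+_; _*_; _^_; _∸_; _≤_; _<_; z≤n; s≤s; _≡ᵇ_; _!) renaming (_≟_ to _≟ⁿ_)
open import Data.Nat.Properties
open import Data.Nat.ListAction using (sum; product)
open import Data.Bool using (Bool; true; false; _∧_; _∨_; not; _xor_; if_then_else_)
open import Data.Bool.Properties using (T-≡; ⇔→≡; ∨-comm; not-distribʳ-xor; xor-identityʳ; not-¬) renaming (_≟_ to _≟ᵇ_)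
open import Data.Bool.ListAction using (all; any)
open import Data.Fin using (Fin; zero; suc) renaming (_≟_ to _≟ᶠ_; _<_ to _<ᶠ_; _<?_ to _<ᶠ?_)
open import Data.Fin.Properties using () renaming (<-cmp to <-cmpᶠ; suc-injective to Fin-suc-injective)
open import Data.List using (List; []; _∷_; map; concatMap; length; allFin; tabulate; lookup; _++_; applyUpTo)
  renaming (filterᵇ to filter)
open import Data.List.Properties using (length-tabulate; map-tabulate; tabulate-lookup)
open import Data.List.Membership.Propositional using (_∈_)
open import Data.List.Membership.Propositional.Properties
  using (∈-allFin; ∈-lookup; ∈-filter⁻; ∈-filter⁺; ∈-map⁺; ∈-concatMap⁺; ∈-++⁺ˡ; ∈-++⁺ʳ)
open import Data.List.Relation.Unary.Any using (here; there; index)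
import Data.List.Relation.Unary.Any as Any
open import Data.List.Relation.Unary.Any.Properties using (lookup-index)
import Data.List.Relation.Unary.All as All
open import Data.List.Relation.Unary.AllPairs using (_∷_)
open import Data.List.Relation.Unary.Unique.Propositional using (Unique)
open import Data.List.Relation.Unary.Unique.Propositional.Properties using ()
  renaming (allFin⁺ to allFin-unique; filter⁺ to filter-unique)
open import Data.Product using (_×_; _,_; proj₁; proj₂; ∃-syntax)
open import Data.Sum using (_⊎_; inj₁; inj₂)
open import Function using (_∘_; _⇔_; mk⇔; Equivalence)
open import Relation.Binary.Definitions using (DecidableEquality; tri<; tri≈; tri>)
open import Relation.Binary.PropositionalEquality hiding (isEquivalence)
open import Relation.Nullary.Decidable using (Dec; yes; no; ⌊_⌋; T?; fromWitness; toWitness; ⌊⌋-map′)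
open import Relation.Nullary.Negation using (contradiction)

⟦_⟧ : Bool → ℕ
⟦ true ⟧ = 1
⟦ false ⟧ = 0

⟦∧⟧ : (a b : Bool) → ⟦ a ∧ b ⟧ ≡ ⟦ a ⟧ * ⟦ b ⟧
⟦∧⟧ true true = refl
⟦∧⟧ true false = refl
⟦∧⟧ false b = refl

⟦⟧≤1 : (b : Bool) → ⟦ b ⟧ ≤ 1
⟦⟧≤1 true = s≤s z≤n
⟦⟧≤1 false = z≤n

⟦⟧-cong-⇔ : {a b : Bool} → (a ≡ true → b ≡ true) → (b ≡ true → a ≡ true) → ⟦ a ⟧ ≡ ⟦ b ⟧
⟦⟧-cong-⇔ {false} {false} _ _ = refl
⟦⟧-cong-⇔ {false} {true} _ b⇒a with b⇒a refl
... | ()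
⟦⟧-cong-⇔ {true} a⇒b _ rewrite a⇒b refl = refl

⟦⟧-mono : {a b : Bool} → (a ≡ true → b ≡ true) → ⟦ a ⟧ ≤ ⟦ b ⟧
⟦⟧-mono {false} _ = z≤n
⟦⟧-mono {true} a⇒b rewrite a⇒b refl = s≤s z≤n

∑ : {A : Set} → List A → (A → ℕ) → ℕ
∑ xs f = sum (map f xs)

syntax ∑ xs (λ x → e) = ∑[ x ∈ xs ] e

module _ {A : Set} where

  ∑-++ : (xs ys : List A) (f : A → ℕ) → ∑ (xs ++ ys) f ≡ ∑ xs f + ∑ ys f
  ∑-++ [] ys f = refl
  ∑-++ (x ∷ xs) ys f = trans (cong (f x +_) (∑-++ xs ys f)) (sym (+-assoc (f x) _ _))

  ∑-cong-∈ : (xs : List A) {f g : A → ℕ} → (∀ x → x ∈ xs → f x ≡ g x) → ∑ xs f ≡ ∑ xs g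
  ∑-cong-∈ [] eq = refl
  ∑-cong-∈ (x ∷ xs) eq = cong₂ _+_ (eq x (here refl)) (∑-cong-∈ xs (λ y y∈ → eq y (there y∈)))

  ∑-cong : (xs : List A) {f g : A → ℕ} → (∀ x → f x ≡ g x) → ∑ xs f ≡ ∑ xs g
  ∑-cong xs eq = ∑-cong-∈ xs (λ x _ → eq x)

  ∑-distrib-+ : (xs : List A) (f g : A → ℕ) → ∑[ x ∈ xs ] (f x + g x) ≡ ∑ xs f + ∑ xs g
  ∑-distrib-+ [] f g = refl
  ∑-distrib-+ (x ∷ xs) f g =
    trans (cong (f x + g x +_) (∑-distrib-+ xs f g)) (+-+-swap (f x) (g x) _ _)
    where
    +-+-swap : ∀ a b c d → a + b + (c + d) ≡ a + c + (b + d)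
    +-+-swap a b c d = begin
      a + b + (c + d)   ≡⟨ +-assoc a b (c + d) ⟩
      a + (b + (c + d)) ≡⟨ cong (a +_) (+-comm b (c + d)) ⟩
      a + (c + d + b)   ≡⟨ cong (a +_) (+-assoc c d b) ⟩
      a + (c + (d + b)) ≡⟨ cong (λ z → a + (c + z)) (+-comm d b) ⟩
      a + (c + (b + d)) ≡⟨ sym (+-assoc a c (b + d)) ⟩
      a + c + (b + d)   ∎
      where open ≡-Reasoning

  *-distribˡ-∑ : (c : ℕ) (xs : List A) (f : A → ℕ) → ∑[ x ∈ xs ] (c * f x) ≡ c * ∑ xs f
  *-distribˡ-∑ c [] f = sym (*-zeroʳ c)
  *-distribˡ-∑ c (x ∷ xs) f =
    trans (cong (c * f x +_) (*-distribˡ-∑ c xs f)) (sym (*-distribˡ-+ c (f x) (∑ xs f)))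

  *-distribʳ-∑ : (c : ℕ) (xs : List A) (f : A → ℕ) → ∑[ x ∈ xs ] (f x * c) ≡ ∑ xs f * c
  *-distribʳ-∑ c xs f =
    trans (∑-cong xs (λ x → *-comm (f x) c)) (trans (*-distribˡ-∑ c xs f) (*-comm c _))

  ∑-zero : (xs : List A) → ∑[ x ∈ xs ] 0 ≡ 0
  ∑-zero [] = refl
  ∑-zero (x ∷ xs) = ∑-zero xs

  ∑-one : (xs : List A) → ∑[ x ∈ xs ] 1 ≡ length xs
  ∑-one [] = refl
  ∑-one (x ∷ xs) = cong suc (∑-one xs)

  length-filter : (p : A → Bool) (xs : List A) → length (filter p xs) ≡ ∑[ x ∈ xs ] ⟦ p x ⟧
  length-filter p [] = refl
  length-filter p (x ∷ xs) with p x
  ... | true = cong suc (length-filter p xs)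
  ... | false = length-filter p xs

  length-filter-cong : {p q : A → Bool} (xs : List A) → (∀ x → p x ≡ q x) → length (filter p xs) ≡ length (filter q xs)
  length-filter-cong {p} {q} xs p≗q =
    trans (length-filter p xs) (trans (∑-cong xs (cong ⟦_⟧ ∘ p≗q)) (sym (length-filter q xs)))

  ∑-filter : (p : A → Bool) (xs : List A) (f : A → ℕ) →
             ∑ (filter p xs) f ≡ ∑[ x ∈ xs ] (⟦ p x ⟧ * f x)
  ∑-filter p [] f = refl
  ∑-filter p (x ∷ xs) f with p x
  ... | true = cong₂ _+_ (sym (+-identityʳ (f x))) (∑-filter p xs f)
  ... | false = ∑-filter p xs f

  ∑-mono : (xs : List A) {f g : A → ℕ} → (∀ x → f x ≤ g x) → ∑ xs f ≤ ∑ xs g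
  ∑-mono [] le = z≤n
  ∑-mono (x ∷ xs) le = +-mono-≤ (le x) (∑-mono xs le)

  ∑-mono-< : {xs : List A} {f g : A → ℕ} → (∀ x → f x ≤ g x) →
             ∀ {y} → y ∈ xs → f y < g y → ∑ xs f < ∑ xs g
  ∑-mono-< {x ∷ xs} le (here refl) lt = +-mono-<-≤ lt (∑-mono xs le)
  ∑-mono-< {x ∷ xs} le (there y∈) lt = +-mono-≤-< (le x) (∑-mono-< le y∈ lt)

  ≤-∑ : {xs : List A} (f : A → ℕ) → ∀ {y} → y ∈ xs → f y ≤ ∑ xs f
  ≤-∑ {x ∷ xs} f (here refl) = m≤m+n (f x) _
  ≤-∑ {x ∷ xs} f (there y∈) = ≤-trans (≤-∑ f y∈) (m≤n+m _ (f x))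

  ∑-indicator≤length : (xs : List A) (p : A → Bool) → ∑[ x ∈ xs ] ⟦ p x ⟧ ≤ length xs
  ∑-indicator≤length [] p = z≤n
  ∑-indicator≤length (x ∷ xs) p = +-mono-≤ (⟦⟧≤1 (p x)) (∑-indicator≤length xs p)

module _ {A B : Set} where

  ∑-map : (g : A → B) (xs : List A) (f : B → ℕ) → ∑ (map g xs) f ≡ ∑ xs (f ∘ g)
  ∑-map g [] f = refl
  ∑-map g (x ∷ xs) f = cong (f (g x) +_) (∑-map g xs f)

  ∑-concatMap : (g : A → List B) (xs : List A) (f : B → ℕ) →
                ∑ (concatMap g xs) f ≡ ∑[ x ∈ xs ] ∑ (g x) f
  ∑-concatMap g [] f = refl
  ∑-concatMap g (x ∷ xs) f = trans (∑-++ (g x) _ f) (cong (∑ (g x) f +_) (∑-concatMap g xs f))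

  ∑-comm : (xs : List A) (ys : List B) (f : A → B → ℕ) →
           ∑[ x ∈ xs ] ∑[ y ∈ ys ] f x y ≡ ∑[ y ∈ ys ] ∑[ x ∈ xs ] f x y
  ∑-comm [] ys f = sym (∑-zero ys)
  ∑-comm (x ∷ xs) ys f =
    trans (cong (∑ ys (f x) +_) (∑-comm xs ys f)) (sym (∑-distrib-+ ys (f x) _))

∧⁻ˡ : {a b : Bool} → a ∧ b ≡ true → a ≡ true
∧⁻ˡ {true} _ = refl

∧⁻ʳ : {a b : Bool} → a ∧ b ≡ true → b ≡ true
∧⁻ʳ {true} h = h

∧⁺ : {a b : Bool} → a ≡ true → b ≡ true → a ∧ b ≡ true
∧⁺ refl refl = refl

∨⁺ˡ : {a b : Bool} → a ≡ true → a ∨ b ≡ true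
∨⁺ˡ refl = refl

∨⁺ʳ : {a b : Bool} → b ≡ true → a ∨ b ≡ true
∨⁺ʳ {true} _ = refl
∨⁺ʳ {false} h = h

∨⁻ : {a b : Bool} → a ∨ b ≡ true → a ≡ true ⊎ b ≡ true
∨⁻ {true} _ = inj₁ refl
∨⁻ {false} h = inj₂ h

not⁻ : {b : Bool} → not b ≡ true → b ≡ false
not⁻ {false} _ = refl

not⁺ : {b : Bool} → b ≡ false → not b ≡ true
not⁺ refl = refl

module _ {A : Set} {a? : Dec A} where

  ⌊⌋⁺ : A → ⌊ a? ⌋ ≡ true
  ⌊⌋⁺ a = Equivalence.to T-≡ (fromWitness a)

  ⌊⌋⁻ : ⌊ a? ⌋ ≡ true → A
  ⌊⌋⁻ h = toWitness (Equivalence.from T-≡ h)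

module DecidableEqualityTest {A : Set} (_≟_ : DecidableEquality A) where

  _≡?_ : A → A → Bool
  x ≡? y = ⌊ x ≟ y ⌋

  ≡?⇒≡ : {x y : A} → x ≡? y ≡ true → x ≡ y
  ≡?⇒≡ = ⌊⌋⁻

  ≡?-refl : (x : A) → x ≡? x ≡ true
  ≡?-refl x = ⌊⌋⁺ refl

  ≢⇒≡?-false : {x y : A} → x ≢ y → x ≡? y ≡ false
  ≢⇒≡?-false {x} {y} x≢y with x ≟ y
  ... | yes x≡y = contradiction x≡y x≢y
  ... | no _ = refl

  ≡?-sym : (x y : A) → x ≡? y ≡ y ≡? x
  ≡?-sym x y with x ≟ y | y ≟ x
  ... | yes _ | yes _ = refl
  ... | no _ | no _ = refl
  ... | yes x≡y | no y≢x = contradiction (sym x≡y) y≢x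
  ... | no x≢y | yes y≡x = contradiction (sym y≡x) x≢y

module _ {A : Set} where

  all⁻ : (p : A → Bool) {xs : List A} → all p xs ≡ true → ∀ {x} → x ∈ xs → p x ≡ true
  all⁻ p {y ∷ xs} h (here refl) = ∧⁻ˡ h
  all⁻ p {y ∷ xs} h (there x∈) = all⁻ p (∧⁻ʳ {p y} h) x∈

  all⁺ : (p : A → Bool) (xs : List A) → (∀ x → x ∈ xs → p x ≡ true) → all p xs ≡ true
  all⁺ p [] h = refl
  all⁺ p (x ∷ xs) h = ∧⁺ (h x (here refl)) (all⁺ p xs (λ y y∈ → h y (there y∈)))

  all-false⁻ : (p : A → Bool) (xs : List A) → all p xs ≡ false → ∃[ x ] (x ∈ xs × p x ≡ false)
  all-false⁻ p (x ∷ xs) h with p x in eq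
  ... | false = x , here refl , eq
  ... | true with all-false⁻ p xs h
  ... | y , y∈ , e = y , there y∈ , e

  any⁻ : (p : A → Bool) (xs : List A) → any p xs ≡ true → ∃[ x ] (x ∈ xs × p x ≡ true)
  any⁻ p (x ∷ xs) h with p x in eq
  ... | true = x , here refl , eq
  ... | false with any⁻ p xs h
  ... | y , y∈ , e = y , there y∈ , e

  any⁺ : (p : A → Bool) {xs : List A} {x : A} → x ∈ xs → p x ≡ true → any p xs ≡ true
  any⁺ p (here refl) e rewrite e = refl
  any⁺ p {y ∷ xs} (there x∈) e = ∨⁺ʳ {p y} (any⁺ p x∈ e)

  all-cong : {p q : A → Bool} (xs : List A) → (∀ x → x ∈ xs → p x ≡ q x) → all p xs ≡ all q xs
  all-cong [] h = refl
  all-cong (x ∷ xs) h = cong₂ _∧_ (h x (here refl)) (all-cong xs (λ y y∈ → h y (there y∈)))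

  any-cong : {p q : A → Bool} (xs : List A) → (∀ x → x ∈ xs → p x ≡ q x) → any p xs ≡ any q xs
  any-cong [] h = refl
  any-cong (x ∷ xs) h = cong₂ _∨_ (h x (here refl)) (any-cong xs (λ y y∈ → h y (there y∈)))

module _ {n : ℕ} where

  all-allFin⁻ : (p : Fin n → Bool) → all p (allFin n) ≡ true → ∀ i → p i ≡ true
  all-allFin⁻ p h i = all⁻ p h (∈-allFin i)

  all-allFin⁺ : (p : Fin n → Bool) → (∀ i → p i ≡ true) → all p (allFin n) ≡ true
  all-allFin⁺ p h = all⁺ p (allFin n) (λ i _ → h i)

  all-allFin-cong : {p q : Fin n → Bool} → (∀ i → p i ≡ q i) → all p (allFin n) ≡ all q (allFin n)
  all-allFin-cong h = all-cong (allFin n) (λ i _ → h i)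

module _ {n : ℕ} where
  open DecidableEqualityTest (_≟ᶠ_ {n}) public
    using () renaming (≡?⇒≡ to ==⇒≡; ≡?-refl to ==-refl; ≢⇒≡?-false to ≢⇒==-false; ≡?-sym to ==-sym)

open DecidableEqualityTest _≟ᵇ_
  using () renaming (_≡?_ to _==ᵇ_; ≡?⇒≡ to ==ᵇ⇒≡; ≡?-refl to ==ᵇ-refl; ≢⇒≡?-false to ≢⇒==ᵇ-false)

∑-allFin-suc : (n : ℕ) (f : Fin (suc n) → ℕ) → ∑ (allFin (suc n)) f ≡ f zero + ∑ (allFin n) (f ∘ suc)
∑-allFin-suc n f = cong (f zero +_) (trans (cong (λ xs → ∑ xs f) (sym (map-tabulate (λ i → i) suc)))
                                           (∑-map suc (allFin n) f))

record IsEnumeration {A : Set} (eq : A → A → Bool) (xs : List A) : Set where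
  constructor enumerates
  field
    multiplicity-one : ∀ a → ∑[ x ∈ xs ] ⟦ eq x a ⟧ ≡ 1

open IsEnumeration

allFin-isEnumeration : (n : ℕ) → IsEnumeration _==_ (allFin n)
allFin-isEnumeration n = enumerates (one n)
  where
  one : ∀ n (a : Fin n) → ∑[ i ∈ allFin n ] ⟦ i == a ⟧ ≡ 1
  one (suc n) zero = trans (∑-allFin-suc n (λ i → ⟦ i == zero ⟧)) (cong suc (∑-zero (allFin n)))
  one (suc n) (suc a) =
    trans (∑-allFin-suc n (λ i → ⟦ i == suc a ⟧)) (trans (∑-cong (allFin n) (λ i → cong ⟦_⟧ (==-suc i))) (one n a))
    where
    ==-suc : ∀ i → (suc i == suc a) ≡ (i == a)
    ==-suc i = ⌊⌋-map′ _ _ (i ≟ᶠ a)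

bools-isEnumeration : IsEnumeration _==ᵇ_ bools
bools-isEnumeration = enumerates λ { true → refl ; false → refl }

module _ {A : Set} where

  ∑-indicator-delta : {eq : A → A → Bool} {xs : List A} → IsEnumeration eq xs → (a : A) (f : A → ℕ) →
                      (∀ x → eq x a ≡ true → f x ≡ f a) → ∑[ x ∈ xs ] (⟦ eq x a ⟧ * f x) ≡ f a
  ∑-indicator-delta {eq} {xs} enum a f resp = begin
    ∑[ x ∈ xs ] (⟦ eq x a ⟧ * f x) ≡⟨ ∑-cong xs pointwise ⟩
    ∑[ x ∈ xs ] (⟦ eq x a ⟧ * f a) ≡⟨ *-distribʳ-∑ (f a) xs _ ⟩
    ∑[ x ∈ xs ] ⟦ eq x a ⟧ * f a   ≡⟨ cong (_* f a) (multiplicity-one enum a) ⟩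
    1 * f a                        ≡⟨ *-identityˡ (f a) ⟩
    f a                            ∎
    where
    open ≡-Reasoning
    pointwise : ∀ x → ⟦ eq x a ⟧ * f x ≡ ⟦ eq x a ⟧ * f a
    pointwise x with eq x a in e
    ... | true = cong (_+ 0) (resp x e)
    ... | false = refl

pointwiseEq : {A : Set} (eq : A → A → Bool) {n : ℕ} → (Fin n → A) → (Fin n → A) → Bool
pointwiseEq eq {zero} f g = true
pointwiseEq eq {suc n} f g = eq (f zero) (g zero) ∧ pointwiseEq eq (f ∘ suc) (g ∘ suc)

module _ {A : Set} (eq : A → A → Bool) where

  pointwiseEq⁻ : {n : ℕ} {f g : Fin n → A} → pointwiseEq eq f g ≡ true → ∀ i → eq (f i) (g i) ≡ true
  pointwiseEq⁻ {suc n} h zero = ∧⁻ˡ h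
  pointwiseEq⁻ {suc n} {f} h (suc i) = pointwiseEq⁻ (∧⁻ʳ {eq (f zero) _} h) i

  pointwiseEq⁺ : {n : ℕ} {f g : Fin n → A} → (∀ i → eq (f i) (g i) ≡ true) → pointwiseEq eq f g ≡ true
  pointwiseEq⁺ {zero} h = refl
  pointwiseEq⁺ {suc n} h = ∧⁺ (h zero) (pointwiseEq⁺ (h ∘ suc))

  allFuns-isEnumeration : {xs : List A} → IsEnumeration eq xs → (n : ℕ) →
                          IsEnumeration (pointwiseEq eq {n}) (allFuns xs n)
  allFuns-isEnumeration enum zero = enumerates λ g → refl
  allFuns-isEnumeration {xs} enum (suc n) = enumerates λ g → begin
    ∑[ f ∈ allFuns xs (suc n) ] ⟦ pointwiseEq eq f g ⟧
      ≡⟨ ∑-concatMap _ xs _ ⟩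
    ∑[ a ∈ xs ] ∑ (map _ (allFuns xs n)) (λ f → ⟦ pointwiseEq eq f g ⟧)
      ≡⟨ ∑-cong xs (λ a → ∑-map _ (allFuns xs n) _) ⟩
    ∑[ a ∈ xs ] ∑[ f ∈ allFuns xs n ] ⟦ eq a (g zero) ∧ pointwiseEq eq f (g ∘ suc) ⟧
      ≡⟨ ∑-cong xs (λ a → ∑-cong (allFuns xs n) (λ f → ⟦∧⟧ (eq a (g zero)) _)) ⟩
    ∑[ a ∈ xs ] ∑[ f ∈ allFuns xs n ] (⟦ eq a (g zero) ⟧ * ⟦ pointwiseEq eq f (g ∘ suc) ⟧)
      ≡⟨ ∑-cong xs (λ a → *-distribˡ-∑ ⟦ eq a (g zero) ⟧ (allFuns xs n) _) ⟩
    ∑[ a ∈ xs ] (⟦ eq a (g zero) ⟧ * ∑[ f ∈ allFuns xs n ] ⟦ pointwiseEq eq f (g ∘ suc) ⟧)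
      ≡⟨ ∑-cong xs (λ a → cong (⟦ eq a (g zero) ⟧ *_) (multiplicity-one (allFuns-isEnumeration enum n) (g ∘ suc))) ⟩
    ∑[ a ∈ xs ] (⟦ eq a (g zero) ⟧ * 1)
      ≡⟨ ∑-cong xs (λ a → *-identityʳ _) ⟩
    ∑[ a ∈ xs ] ⟦ eq a (g zero) ⟧
      ≡⟨ multiplicity-one enum (g zero) ⟩
    1 ∎
    where open ≡-Reasoning

allFuns-complete : {A : Set} {xs : List A} → (∀ a → a ∈ xs) → (n : ℕ) (f : Fin n → A) →
                   ∃[ g ] (g ∈ allFuns xs n × (∀ i → g i ≡ f i))
allFuns-complete {A} all∈ zero f = (λ ()) , here refl , (λ ())
allFuns-complete {A} all∈ (suc n) f with allFuns-complete all∈ n (f ∘ suc)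
... | g , g∈ , g≗f = _ , ∈-concatMap⁺ _ (Any.map (λ { refl → ∈-map⁺ _ g∈ }) (all∈ (f zero)))
                       , λ { zero → refl ; (suc i) → g≗f i }

length-allFuns : {A : Set} (xs : List A) (n : ℕ) → length (allFuns xs n) ≡ length xs ^ n
length-allFuns xs zero = refl
length-allFuns xs (suc n) = begin
  length (allFuns xs (suc n))
    ≡⟨ sym (∑-one (allFuns xs (suc n))) ⟩
  ∑[ f ∈ allFuns xs (suc n) ] 1
    ≡⟨ ∑-concatMap _ xs _ ⟩
  ∑[ a ∈ xs ] ∑ (map _ (allFuns xs n)) (λ _ → 1)
    ≡⟨ ∑-cong xs (λ a → trans (∑-map _ (allFuns xs n) _) (∑-one (allFuns xs n))) ⟩
  ∑[ a ∈ xs ] length (allFuns xs n)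
    ≡⟨ ∑-cong xs (λ a → trans (length-allFuns xs n) (sym (*-identityˡ _))) ⟩
  ∑[ a ∈ xs ] (1 * length xs ^ n)
    ≡⟨ *-distribʳ-∑ (length xs ^ n) xs _ ⟩
  ∑[ a ∈ xs ] 1 * length xs ^ n
    ≡⟨ cong (_* length xs ^ n) (∑-one xs) ⟩
  length xs * length xs ^ n ∎
  where open ≡-Reasoning

pairEq : {A B : Set} → (A → A → Bool) → (B → B → Bool) → A × B → A × B → Bool
pairEq eqA eqB (a , b) (a′ , b′) = eqA a a′ ∧ eqB b b′

allPairs : {A B : Set} → List A → List B → List (A × B)
allPairs xs ys = concatMap (λ a → map (a ,_) ys) xs

allPairs-isEnumeration : {A B : Set} {eqA : A → A → Bool} {eqB : B → B → Bool} {xs : List A} {ys : List B} →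
                         IsEnumeration eqA xs → IsEnumeration eqB ys → IsEnumeration (pairEq eqA eqB) (allPairs xs ys)
allPairs-isEnumeration {eqA = eqA} {eqB} {xs} {ys} enumA enumB = enumerates λ { (a , b) → begin
  ∑[ p ∈ allPairs xs ys ] ⟦ pairEq eqA eqB p (a , b) ⟧
    ≡⟨ ∑-concatMap _ xs _ ⟩
  ∑[ a′ ∈ xs ] ∑ (map (a′ ,_) ys) (λ p → ⟦ pairEq eqA eqB p (a , b) ⟧)
    ≡⟨ ∑-cong xs (λ a′ → ∑-map _ ys _) ⟩
  ∑[ a′ ∈ xs ] ∑[ b′ ∈ ys ] ⟦ eqA a′ a ∧ eqB b′ b ⟧
    ≡⟨ ∑-cong xs (λ a′ → trans (∑-cong ys (λ b′ → ⟦∧⟧ (eqA a′ a) _))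
                              (*-distribˡ-∑ ⟦ eqA a′ a ⟧ ys _)) ⟩
  ∑[ a′ ∈ xs ] (⟦ eqA a′ a ⟧ * ∑[ b′ ∈ ys ] ⟦ eqB b′ b ⟧)
    ≡⟨ ∑-cong xs (λ a′ → trans (cong (⟦ eqA a′ a ⟧ *_) (multiplicity-one enumB b)) (*-identityʳ _)) ⟩
  ∑[ a′ ∈ xs ] ⟦ eqA a′ a ⟧
    ≡⟨ multiplicity-one enumA a ⟩
  1 ∎ }
  where open ≡-Reasoning

-- Double counting the pairs (x , y) with y ≈ F x and p x, which are exactly those with x ≈ G y and q y.
count-bijection : {A B : Set} {eqA : A → A → Bool} {eqB : B → B → Bool} {xs : List A} {ys : List B} →
                  IsEnumeration eqA xs → IsEnumeration eqB ys →
                  (F : A → B) (G : B → A) (p : A → Bool) (q : B → Bool) →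
                  (∀ x y → (eqB y (F x) ∧ p x ≡ true) ⇔ (eqA x (G y) ∧ q y ≡ true)) →
                  ∑[ x ∈ xs ] ⟦ p x ⟧ ≡ ∑[ y ∈ ys ] ⟦ q y ⟧
count-bijection {eqA = eqA} {eqB} {xs} {ys} enumA enumB F G p q F⇔G = begin
  ∑[ x ∈ xs ] ⟦ p x ⟧
    ≡⟨ ∑-cong xs (λ x → sym (∑-indicator-delta enumB (F x) (λ _ → ⟦ p x ⟧) (λ _ _ → refl))) ⟩
  ∑[ x ∈ xs ] ∑[ y ∈ ys ] (⟦ eqB y (F x) ⟧ * ⟦ p x ⟧)
    ≡⟨ ∑-cong xs (λ x → ∑-cong ys (λ y → swap x y)) ⟩
  ∑[ x ∈ xs ] ∑[ y ∈ ys ] (⟦ eqA x (G y) ⟧ * ⟦ q y ⟧)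
    ≡⟨ ∑-comm xs ys _ ⟩
  ∑[ y ∈ ys ] ∑[ x ∈ xs ] (⟦ eqA x (G y) ⟧ * ⟦ q y ⟧)
    ≡⟨ ∑-cong ys (λ y → ∑-indicator-delta enumA (G y) (λ _ → ⟦ q y ⟧) (λ _ _ → refl)) ⟩
  ∑[ y ∈ ys ] ⟦ q y ⟧ ∎
  where
  open ≡-Reasoning
  swap : ∀ x y → ⟦ eqB y (F x) ⟧ * ⟦ p x ⟧ ≡ ⟦ eqA x (G y) ⟧ * ⟦ q y ⟧
  swap x y = trans (sym (⟦∧⟧ (eqB y (F x)) (p x)))
    (trans (⟦⟧-cong-⇔ (Equivalence.to (F⇔G x y)) (Equivalence.from (F⇔G x y))) (⟦∧⟧ (eqA x (G y)) (q y)))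

∑-allFuns-suc : {A : Set} (xs : List A) (n : ℕ) (P : (Fin (suc n) → A) → ℕ) (Q : A → (Fin n → A) → ℕ) →
                (∀ φ → P φ ≡ Q (φ zero) (φ ∘ suc)) → ∑ (allFuns xs (suc n)) P ≡ ∑[ a ∈ xs ] ∑ (allFuns xs n) (Q a)
∑-allFuns-suc xs n P Q P≡Q =
  trans (∑-concatMap _ xs P) (∑-cong xs λ a → trans (∑-map _ (allFuns xs n) P) (∑-cong (allFuns xs n) λ f → P≡Q _))

record EquivalenceRel {n : ℕ} (R : Rel n) : Set where
  field
    reflexive : ∀ u → R u u ≡ true
    symmetric : ∀ {u v} → R u v ≡ true → R v u ≡ true
    transitive : ∀ {u v w} → R u v ≡ true → R v w ≡ true → R u w ≡ true

module _ {n : ℕ} (R : Rel n) where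

  isEquivalence-sound : isEquivalence R ≡ true → EquivalenceRel R
  isEquivalence-sound h = record
    { reflexive = all-allFin⁻ (λ u → R u u) (∧⁻ˡ h)
    ; symmetric = λ {u} {v} uRv → implies (R u v) (all-allFin⁻ _ (all-allFin⁻ _ sym-test u) v) uRv
    ; transitive = λ {u} {v} {w} uRv vRw →
        implies (R u v ∧ R v w) (all-allFin⁻ _ (all-allFin⁻ _ (all-allFin⁻ _ trans-test u) v) w) (∧⁺ uRv vRw)
    }
    where
    sym-test = ∧⁻ˡ (∧⁻ʳ {all (λ u → R u u) (allFin n)} h)
    trans-test = ∧⁻ʳ {all (λ u → all (λ v → not (R u v) ∨ R v u) (allFin n)) (allFin n)}
                     (∧⁻ʳ {all (λ u → R u u) (allFin n)} h)
    implies : ∀ a {b} → not a ∨ b ≡ true → a ≡ true → b ≡ true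
    implies true h refl = h

  isEquivalence-complete : EquivalenceRel R → isEquivalence R ≡ true
  isEquivalence-complete E =
    ∧⁺ (all-allFin⁺ _ reflexive)
       (∧⁺ (all-allFin⁺ _ λ u → all-allFin⁺ _ λ v → implication (R u v) symmetric)
           (all-allFin⁺ _ λ u → all-allFin⁺ _ λ v → all-allFin⁺ _ λ w →
              implication (R u v ∧ R v w) (λ h → transitive (∧⁻ˡ h) (∧⁻ʳ {R u v} h))))
    where
    open EquivalenceRel E
    implication : ∀ a {b} → (a ≡ true → b ≡ true) → not a ∨ b ≡ true
    implication false _ = refl
    implication true a⇒b = a⇒b refl

isEquivalence-cong : {n : ℕ} {R R′ : Rel n} → (∀ u v → R u v ≡ R′ u v) → isEquivalence R ≡ isEquivalence R′
isEquivalence-cong e =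
  cong₂ _∧_ (all-allFin-cong λ u → e u u)
    (cong₂ _∧_ (all-allFin-cong λ u → all-allFin-cong λ v → cong₂ _∨_ (cong not (e u v)) (e v u))
               (all-allFin-cong λ u → all-allFin-cong λ v → all-allFin-cong λ w →
                  cong₂ _∨_ (cong not (cong₂ _∧_ (e u v) (e v w))) (e u w)))

least : {n : ℕ} (p : Fin n → Bool) (v : Fin n) → p v ≡ true →
        ∃[ u ] (p u ≡ true × (∀ w → w <ᶠ u → p w ≡ false))
least {suc n} p v pv with p zero in p0
... | true = zero , p0 , (λ w ())
least {suc n} p zero pv | false = contradiction (trans (sym p0) pv) λ ()
least {suc n} p (suc v) pv | false with least (p ∘ suc) v pv
... | u , pu , below = suc u , pu , λ { zero _ → p0 ; (suc w) (s≤s w<u) → below w w<u }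

lookup-injective : {A : Set} {xs : List A} → Unique xs → (i j : Fin (length xs)) → lookup xs i ≡ lookup xs j → i ≡ j
lookup-injective {xs = x ∷ xs} _ zero zero _ = refl
lookup-injective {xs = x ∷ xs} (x∉ ∷ _) zero (suc j) e = contradiction e (All.lookup x∉ (∈-lookup j))
lookup-injective {xs = x ∷ xs} (x∉ ∷ _) (suc i) zero e = contradiction (sym e) (All.lookup x∉ (∈-lookup i))
lookup-injective {xs = x ∷ xs} (_ ∷ u) (suc i) (suc j) e = cong suc (lookup-injective u i j e)

module Classes {n : ℕ} {R : Rel n} (E : EquivalenceRel R) where

  open EquivalenceRel E

  isRep : Fin n → Bool
  isRep v = not (any (λ u → ⌊ u <ᶠ? v ⌋ ∧ R u v) (allFin n))

  classCount : ℕ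
  classCount = length (classReps R)

  rep : Fin classCount → Fin n
  rep = lookup (classReps R)

  rep-isRep : ∀ j → isRep (rep j) ≡ true
  rep-isRep j = Equivalence.to T-≡ (proj₂ (∈-filter⁻ (T? ∘ isRep) {xs = allFin n} (∈-lookup j)))

  isRep⁺ : ∀ v → (∀ w → w <ᶠ v → R w v ≡ false) → isRep v ≡ true
  isRep⁺ v minimal with any (λ u → ⌊ u <ᶠ? v ⌋ ∧ R u v) (allFin n) in smaller
  ... | false = refl
  ... | true with any⁻ _ (allFin n) smaller
  ... | w , _ , w<v∧wRv =
    contradiction (trans (sym (∧⁻ʳ {⌊ w <ᶠ? v ⌋} w<v∧wRv)) (minimal w (⌊⌋⁻ {a? = w <ᶠ? v} (∧⁻ˡ w<v∧wRv)))) λ ()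

  nothing-below-rep : ∀ j w → w <ᶠ rep j → R w (rep j) ≡ false
  nothing-below-rep j w w<rep with R w (rep j) in wRrep
  ... | false = refl
  ... | true = contradiction (trans (sym someBelow) (not⁻ (rep-isRep j))) λ ()
    where
    someBelow = any⁺ (λ u → ⌊ u <ᶠ? rep j ⌋ ∧ R u (rep j)) (∈-allFin w) (∧⁺ (⌊⌋⁺ w<rep) wRrep)

  reps-unique : Unique (classReps R)
  reps-unique = filter-unique (T? ∘ isRep) (allFin-unique n)

  rep-injective : ∀ i j → R (rep i) (rep j) ≡ true → i ≡ j
  rep-injective i j related = lookup-injective reps-unique i j rep-i≡rep-j
    where
    rep-i≡rep-j : rep i ≡ rep j
    rep-i≡rep-j with <-cmpᶠ (rep i) (rep j)
    ... | tri≈ _ eq _ = eq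
    ... | tri< lt _ _ = contradiction (trans (sym related) (nothing-below-rep j (rep i) lt)) λ ()
    ... | tri> _ _ gt = contradiction (trans (sym (symmetric related)) (nothing-below-rep i (rep j) gt)) λ ()

  findClass : ∀ v → ∃[ j ] (R (rep j) v ≡ true)
  findClass v with least (λ u → R u v) v (reflexive v)
  ... | u , uRv , below = index u∈ , subst (λ z → R z v ≡ true) (lookup-index u∈) uRv
    where
    u∈ : u ∈ classReps R
    u∈ = ∈-filter⁺ (T? ∘ isRep) (∈-allFin u)
           (Equivalence.from T-≡ (isRep⁺ u minimal))
      where
      minimal : ∀ w → w <ᶠ u → R w u ≡ false
      minimal w w<u with R w u in wRu
      ... | false = refl
      ... | true = contradiction (trans (sym (transitive wRu uRv)) (below w w<u)) λ ()

  opaque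
    classOf : Fin n → Fin classCount
    classOf v = proj₁ (findClass v)

    rep-classOf : ∀ v → R (rep (classOf v)) v ≡ true
    rep-classOf v = proj₂ (findClass v)

  classOf-unique : ∀ v j → R (rep j) v ≡ true → classOf v ≡ j
  classOf-unique v j h = rep-injective (classOf v) j (transitive (rep-classOf v) (symmetric h))

  classOf-rep : ∀ j → classOf (rep j) ≡ j
  classOf-rep j = classOf-unique (rep j) j (reflexive (rep j))

  classOf-resp : ∀ {u v} → R u v ≡ true → classOf u ≡ classOf v
  classOf-resp {u} {v} uRv = sym (classOf-unique v (classOf u) (transitive (rep-classOf u) uRv))

  classOf-related : ∀ {u v} → classOf u ≡ classOf v → R u v ≡ true
  classOf-related {u} {v} same =
    transitive (symmetric (rep-classOf u)) (subst (λ j → R (rep j) v ≡ true) (sym same) (rep-classOf v))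

relEq : {n : ℕ} → Rel n → Rel n → Bool
relEq = pointwiseEq (pointwiseEq _==ᵇ_)

relEq⁻ : {n : ℕ} {R R′ : Rel n} → relEq R R′ ≡ true → ∀ u v → R u v ≡ R′ u v
relEq⁻ h u v = ==ᵇ⇒≡ (pointwiseEq⁻ _==ᵇ_ (pointwiseEq⁻ (pointwiseEq _==ᵇ_) h u) v)

relEq⁺ : {n : ℕ} {R R′ : Rel n} → (∀ u v → R u v ≡ R′ u v) → relEq R R′ ≡ true
relEq⁺ h = pointwiseEq⁺ (pointwiseEq _==ᵇ_) λ u → pointwiseEq⁺ _==ᵇ_ λ v →
  subst (λ z → _ ==ᵇ z ≡ true) (h u v) (==ᵇ-refl _)

setPartitions⁻ : {n : ℕ} {π : Rel n} → π ∈ setPartitions n → EquivalenceRel π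
setPartitions⁻ {n} {π} π∈ = isEquivalence-sound π
  (Equivalence.to T-≡ (proj₂ (∈-filter⁻ (T? ∘ isEquivalence) {xs = allFuns (allFuns bools n) n} π∈)))

setPartitions-unique : {n : ℕ} {R : Rel n} → EquivalenceRel R → ∑[ π ∈ setPartitions n ] ⟦ relEq π R ⟧ ≡ 1
setPartitions-unique {n} {R} E = begin
  ∑[ π ∈ setPartitions n ] ⟦ relEq π R ⟧
    ≡⟨ ∑-filter isEquivalence (allFuns (allFuns bools n) n) _ ⟩
  ∑[ π ∈ allFuns (allFuns bools n) n ] (⟦ isEquivalence π ⟧ * ⟦ relEq π R ⟧)
    ≡⟨ ∑-cong (allFuns (allFuns bools n) n) only-equivalences ⟩
  ∑[ π ∈ allFuns (allFuns bools n) n ] ⟦ relEq π R ⟧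
    ≡⟨ multiplicity-one (allFuns-isEnumeration _ (allFuns-isEnumeration _==ᵇ_ bools-isEnumeration n) n) R ⟩
  1 ∎
  where
  open ≡-Reasoning
  only-equivalences : ∀ π → ⟦ isEquivalence π ⟧ * ⟦ relEq π R ⟧ ≡ ⟦ relEq π R ⟧
  only-equivalences π with relEq π R in π≐R
  ... | false = *-zeroʳ ⟦ isEquivalence π ⟧
  ... | true = cong (λ b → ⟦ b ⟧ * 1) (trans (isEquivalence-cong {R = π} {R} (relEq⁻ π≐R)) (isEquivalence-complete R E))

kernel : {n k : ℕ} → (Fin n → Fin k) → Rel n
kernel ℓ u v = ℓ u == ℓ v

kernel-isEquivalence : {N k : ℕ} (ℓ : Fin N → Fin k) → EquivalenceRel (kernel ℓ)
kernel-isEquivalence ℓ = record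
  { reflexive = λ u → ==-refl (ℓ u)
  ; symmetric = λ {u} {v} h → trans (==-sym (ℓ v) (ℓ u)) h
  ; transitive = λ {u} h₁ h₂ → subst (λ z → ℓ u == z ≡ true) (trans (==⇒≡ h₁) (==⇒≡ h₂)) (==-refl (ℓ u))
  }

module Reachability (G : WGraph) where

  private
    N = n G

  adj-sym : ∀ x v → adj G x v ≡ adj G v x
  adj-sym x v = any-cong (edges G) λ { (a , b) _ → ∨-comm (a == x ∧ b == v) (a == v ∧ b == x) }

  record Reach (S : Fin N → Bool) (k : ℕ) (u v : Fin N) : Set where
    constructor reach
    field
      holds : reachIn G S k u v ≡ true

  open Reach public

  reach-refl : ∀ {S} u → S u ≡ true → Reach S 0 u u
  reach-refl u Su = reach (∧⁺ Su (==-refl u))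

  reach-extend : ∀ {S k u} x {v} → Reach S k u x → S v ≡ true → adj G x v ≡ true → Reach S (suc k) u v
  reach-extend {S} {k} {u} x {v} (reach ux) Sv xv =
    reach (∨⁺ʳ {reachIn G S k u v} (any⁺ _ (∈-allFin x) (∧⁺ ux (∧⁺ Sv xv))))

  reach-suc : ∀ {S k u v} → Reach S k u v → Reach S (suc k) u v
  reach-suc (reach h) = reach (∨⁺ˡ h)

  data ReachView (S : Fin N → Bool) (k : ℕ) (u v : Fin N) : Set where
    shorter : Reach S k u v → ReachView S k u v
    through : ∀ x → Reach S k u x → S v ≡ true → adj G x v ≡ true → ReachView S k u v

  reach-view : ∀ {S k u v} → Reach S (suc k) u v → ReachView S k u v
  reach-view {S} {k} {u} {v} (reach h) with ∨⁻ {reachIn G S k u v} h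
  ... | inj₁ uv = shorter (reach uv)
  ... | inj₂ step with any⁻ _ (allFin N) step
  ... | x , _ , ux∧Sv∧xv = through x (reach (∧⁻ˡ ux∧Sv∧xv)) (∧⁻ˡ (∧⁻ʳ {reachIn G S k u x} ux∧Sv∧xv))
                                  (∧⁻ʳ {S v} (∧⁻ʳ {reachIn G S k u x} ux∧Sv∧xv))

  reach-zero⇒≡ : ∀ {S u v} → Reach S 0 u v → u ≡ v
  reach-zero⇒≡ {S} {u} (reach h) = ==⇒≡ (∧⁻ʳ {S u} h)

  reach-source : ∀ {S} k {u v} → Reach S k u v → S u ≡ true
  reach-source zero (reach h) = ∧⁻ˡ h
  reach-source (suc k) h with reach-view h
  ... | shorter uv = reach-source k uv
  ... | through x ux _ _ = reach-source k ux

  reach-target : ∀ {S} k {u v} → Reach S k u v → S v ≡ true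
  reach-target zero h with reach-zero⇒≡ h
  ... | refl = reach-source zero h
  reach-target (suc k) h with reach-view h
  ... | shorter uv = reach-target k uv
  ... | through _ _ Sv _ = Sv

  reach-mono : ∀ {S k m u v} → k ≤ m → Reach S k u v → Reach S m u v
  reach-mono {m = zero} z≤n h = h
  reach-mono {m = suc m} z≤n h = reach-suc (reach-mono z≤n h)
  reach-mono (s≤s k≤m) h with reach-view h
  ... | shorter uv = reach-suc (reach-mono k≤m uv)
  ... | through x ux Sv xv = reach-extend x (reach-mono k≤m ux) Sv xv

  reach-prepend : ∀ {S} k {u x v} → S u ≡ true → adj G u x ≡ true → Reach S k x v → Reach S (suc k) u v
  reach-prepend zero Su ux h with reach-zero⇒≡ h
  ... | refl = reach-extend _ (reach-refl _ Su) (reach-source zero h) ux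
  reach-prepend (suc k) Su ux h with reach-view h
  ... | shorter xv = reach-suc (reach-prepend k Su ux xv)
  ... | through y xy Sv yv = reach-extend y (reach-prepend k Su ux xy) Sv yv

  reach-sym : ∀ {S} k {u v} → Reach S k u v → Reach S k v u
  reach-sym zero h with reach-zero⇒≡ h
  ... | refl = h
  reach-sym (suc k) h with reach-view h
  ... | shorter uv = reach-suc (reach-sym k uv)
  ... | through x ux Sv xv = reach-prepend k Sv (trans (adj-sym _ x) xv) (reach-sym k ux)

  reach-trans : ∀ {S} k m {u x v} → Reach S k u x → Reach S m x v → Reach S (k + m) u v
  reach-trans k zero ux xv with reach-zero⇒≡ xv
  ... | refl = reach-mono (m≤m+n k 0) ux
  reach-trans k (suc m) ux xv rewrite +-suc k m with reach-view xv
  ... | shorter xv′ = reach-suc (reach-trans k m ux xv′)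
  ... | through y xy Sv yv = reach-extend y (reach-trans k m ux xy) Sv yv

  reachIn-cong : ∀ {S S′} → (∀ v → S v ≡ S′ v) → ∀ k u v → reachIn G S k u v ≡ reachIn G S′ k u v
  reachIn-cong S≗S′ zero u v = cong (_∧ (u == v)) (S≗S′ u)
  reachIn-cong {S} {S′} S≗S′ (suc k) u v =
    cong₂ _∨_ (reachIn-cong S≗S′ k u v)
              (any-cong (allFin N) λ x _ → cong₂ _∧_ (reachIn-cong S≗S′ k u x) (cong (_∧ adj G x v) (S≗S′ v)))

  -- The sets reachable in k steps grow until they stop growing; each strict growth step adds a vertex,
  -- so they are stable by step N.
  module Saturation (S : Fin N → Bool) (u : Fin N) where

    reachable : ℕ → Fin N → Bool
    reachable k = reachIn G S k u

    size : ℕ → ℕ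
    size k = ∑[ v ∈ allFin N ] ⟦ reachable k v ⟧

    Stable : ℕ → Set
    Stable k = ∀ v → reachable (suc k) v ≡ reachable k v

    stable-forever : ∀ {k} → Stable k → ∀ d v → reachable (d + k) v ≡ reachable k v
    stable-forever st zero v = refl
    stable-forever {k} st (suc d) v = trans (step-cong {d + k} {k} (stable-forever st d) v) (st v)
      where
      step-cong : ∀ {i j} → (∀ v → reachable i v ≡ reachable j v) → ∀ v → reachable (suc i) v ≡ reachable (suc j) v
      step-cong i≗j v = cong₂ _∨_ (i≗j v) (any-cong (allFin N) λ x _ → cong (_∧ (S v ∧ adj G x v)) (i≗j x))

    stable-or-grows : ∀ k → Stable k ⊎ ∃[ v ] (reachable (suc k) v ≡ true × reachable k v ≡ false)
    stable-or-grows k with all (λ v → reachable (suc k) v ==ᵇ reachable k v) (allFin N) in unchanged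
    ... | true = inj₁ λ v → ==ᵇ⇒≡ (all-allFin⁻ _ unchanged v)
    ... | false with all-false⁻ _ (allFin N) unchanged
    ... | v , _ , changed = inj₂ (v , new (reachable (suc k) v) (reachable k v) changed (holds ∘ reach-suc {S} {k} {u} {v} ∘ reach))
      where
      new : (a b : Bool) → a ==ᵇ b ≡ false → (b ≡ true → a ≡ true) → a ≡ true × b ≡ false
      new true false _ _ = refl , refl
      new false true _ b⇒a = contradiction (b⇒a refl) λ ()

    stable-or-large : S u ≡ true → ∀ k → (∃[ j ] (j ≤ k × Stable j)) ⊎ (suc k ≤ size k)
    stable-or-large Su zero =
      inj₂ (subst (_≤ size 0) (cong ⟦_⟧ (holds (reach-refl {S} u Su))) (≤-∑ (λ v → ⟦ reachable 0 v ⟧) (∈-allFin u)))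
    stable-or-large Su (suc k) with stable-or-large Su k
    ... | inj₁ (j , j≤k , st) = inj₁ (j , m≤n⇒m≤1+n j≤k , st)
    ... | inj₂ large with stable-or-grows k
    ... | inj₁ st = inj₁ (k , n≤1+n k , st)
    ... | inj₂ (v , now , before) =
      inj₂ (≤-trans (s≤s large) (∑-mono-< (λ w → ⟦⟧-mono (holds ∘ reach-suc {S} {k} {u} {w} ∘ reach)) (∈-allFin v) grew))
      where
      grew : ⟦ reachable k v ⟧ < ⟦ reachable (suc k) v ⟧
      grew rewrite now | before = s≤s z≤n

    saturates : ∀ m {v} → Reach S m u v → Reach S N u v
    saturates m {v} h with stable-or-large (reach-source m h) N
    ... | inj₂ large =
      contradiction (≤-trans large (subst (size N ≤_) (length-tabulate (λ i → i)) (∑-indicator≤length (allFin N) (reachable N))))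
                    (<-irrefl refl)
    ... | inj₁ (j , j≤N , st) with ≤-total m N
    ... | inj₁ m≤N = reach-mono m≤N h
    ... | inj₂ N≤m = reach-mono j≤N (reach (trans (sym (stable-forever st (m ∸ j) v))
                                    (holds (subst (λ i → Reach S i u v) (sym (m∸n+n≡m (≤-trans j≤N N≤m))) h))))

  reach-saturates : ∀ {S} m {u v} → Reach S m u v → Reach S N u v
  reach-saturates {S} m {u} = Saturation.saturates S u m

ProperOn : {A : Set} (G : WGraph) → (Fin (n G) → Bool) → (Fin (n G) → A) → Set
ProperOn G C c = ∀ {a b} → (a , b) ∈ edges G → C a ≡ true → C b ≡ true → c a ≢ c b

module _ (G : WGraph) (C : Fin (n G) → Bool) where

  private
    edgeTest : (Fin (n G) → Fin 2) → Fin (n G) × Fin (n G) → Bool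
    edgeTest c (a , b) = not (C a ∧ C b) ∨ not (c a == c b)

  bipartiteOn⁻ : bipartiteOn G C ≡ true → ∃[ c ] ProperOn G C c
  bipartiteOn⁻ bip with any⁻ _ (allFuns (allFin 2) (n G)) bip
  ... | c , _ , allEdges = c , λ ab∈ → edgeTest⁻ (all⁻ (edgeTest c) allEdges ab∈)
    where
    edgeTest⁻ : ∀ {c a b} → edgeTest c (a , b) ≡ true → C a ≡ true → C b ≡ true → c a ≢ c b
    edgeTest⁻ {c} {b = b} h Ca Cb ca≡cb rewrite Ca | Cb | ca≡cb | ==-refl (c b) = contradiction h λ ()

  bipartiteOn⁺ : (c : Fin (n G) → Fin 2) → ProperOn G C c → bipartiteOn G C ≡ true
  bipartiteOn⁺ c proper with allFuns-complete ∈-allFin (n G) c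
  ... | c′ , c′∈ , c′≗c = any⁺ _ c′∈ (all⁺ (edgeTest c′) (edges G) edgeOK)
    where
    edgeOK : ∀ e → e ∈ edges G → edgeTest c′ e ≡ true
    edgeOK (a , b) ab∈ with C a in Ca | C b in Cb
    ... | false | _ = refl
    ... | true | false = refl
    ... | true | true =
      not⁺ (≢⇒==-false λ c′a≡c′b → proper ab∈ Ca Cb (trans (sym (c′≗c a)) (trans c′a≡c′b (c′≗c b))))

adj⇒edge : (G : WGraph) {x v : Fin (n G)} → adj G x v ≡ true → (x , v) ∈ edges G ⊎ (v , x) ∈ edges G
adj⇒edge G {x} {v} h with any⁻ _ (edges G) h
... | (a , b) , ab∈ , test with ∨⁻ {a == x ∧ b == v} test
... | inj₁ ab≡xv = inj₁ (subst₂ (λ p q → (p , q) ∈ edges G) (==⇒≡ (∧⁻ˡ ab≡xv)) (==⇒≡ (∧⁻ʳ {a == x} ab≡xv)) ab∈)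
... | inj₂ ab≡vx = inj₂ (subst₂ (λ p q → (p , q) ∈ edges G) (==⇒≡ (∧⁻ˡ ab≡vx)) (==⇒≡ (∧⁻ʳ {a == v} ab≡vx)) ab∈)

edge⇒adj : (G : WGraph) {a b : Fin (n G)} → (a , b) ∈ edges G → adj G a b ≡ true
edge⇒adj G {a} {b} ab∈ = any⁺ _ ab∈ (∨⁺ˡ (∧⁺ (==-refl a) (==-refl b)))

ProperOn-adj : {A : Set} {G : WGraph} {C : Fin (n G) → Bool} {c : Fin (n G) → A} → ProperOn G C c →
               ∀ {x v} → adj G x v ≡ true → C x ≡ true → C v ≡ true → c x ≢ c v
ProperOn-adj {G = G} proper xv Cx Cv with adj⇒edge G xv
... | inj₁ xv∈ = proper xv∈ Cx Cv
... | inj₂ vx∈ = proper vx∈ Cv Cx ∘ sym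

module PartitionComponents (G : WGraph) {π : Rel (n G)} (E : EquivalenceRel π) where

  open EquivalenceRel E
  open Reachability G

  private
    N = n G

  SC : Rel N
  SC = sameComponent G π

  block-cong : ∀ {u v} → π u v ≡ true → ∀ w → π u w ≡ π v w
  block-cong {u} {v} uπv w with π u w in uπw | π v w in vπw
  ... | true | true = refl
  ... | false | false = refl
  ... | true | false = contradiction (trans (sym (transitive (symmetric uπv) uπw)) vπw) λ ()
  ... | false | true = contradiction (trans (sym (transitive uπv vπw)) uπw) λ ()

  SC⁺ : ∀ {u v} k → Reach (π u) k u v → SC u v ≡ true
  SC⁺ k h = ∧⁺ (reach-target k h) (holds (reach-saturates k h))

  SC⁻ : ∀ {u v} → SC u v ≡ true → Reach (π u) N u v
  SC⁻ {u} h = reach (∧⁻ʳ {π u _} h)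

  SC⇒π : ∀ {u v} → SC u v ≡ true → π u v ≡ true
  SC⇒π = ∧⁻ˡ

  reach-rebase : ∀ {u v} → π u v ≡ true → ∀ {k x y} → Reach (π u) k x y → Reach (π v) k x y
  reach-rebase uπv {k} {x} {y} (reach h) = reach (trans (sym (reachIn-cong (block-cong uπv) k x y)) h)

  SC-equivalence : EquivalenceRel SC
  SC-equivalence = record
    { reflexive = λ u → SC⁺ 0 (reach-refl u (reflexive u))
    ; symmetric = λ h → SC⁺ N (reach-rebase (SC⇒π h) (reach-sym N (SC⁻ h)))
    ; transitive = λ h₁ h₂ → SC⁺ (N + N) (reach-trans N N (SC⁻ h₁) (reach-rebase (symmetric (SC⇒π h₁)) (SC⁻ h₂)))
    }

  edge⇒SC : ∀ {a b} → (a , b) ∈ edges G → π a b ≡ true → SC a b ≡ true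
  edge⇒SC {a} ab∈ aπb = SC⁺ 1 (reach-extend a (reach-refl a (reflexive a)) aπb (edge⇒adj G ab∈))

  properOnBlocks : (Fin N → Bool) → Bool
  properOnBlocks b = all (λ e → not (π (proj₁ e) (proj₂ e) ∧ (b (proj₁ e) ==ᵇ b (proj₂ e)))) (edges G)

  properOnBlocks⁻ : ∀ {b} → properOnBlocks b ≡ true → ∀ r → ProperOn G (π r) b
  properOnBlocks⁻ {b} h r {a} {a′} aa′∈ rπa rπa′ ba≡ba′ with all⁻ _ h aa′∈
  ... | test rewrite transitive (symmetric rπa) rπa′ | ba≡ba′ | ==ᵇ-refl (b a′) = contradiction test λ ()

  properOnBlocks⁺ : ∀ {b} → (∀ {a a′} → (a , a′) ∈ edges G → π a a′ ≡ true → b a ≢ b a′) →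
                    properOnBlocks b ≡ true
  properOnBlocks⁺ {b} proper = all⁺ _ (edges G) λ { (a , a′) aa′∈ → test aa′∈ }
    where
    test : ∀ {a a′} → (a , a′) ∈ edges G → not (π a a′ ∧ (b a ==ᵇ b a′)) ≡ true
    test {a} {a′} aa′∈ with π a a′ in aπa′
    ... | false = refl
    ... | true = not⁺ (≢⇒==ᵇ-false (proper aa′∈ aπa′))

  properOnBlocks-cong : ∀ {b c} → (∀ v → b v ≡ c v) → properOnBlocks b ≡ properOnBlocks c
  properOnBlocks-cong b≗c =
    all-cong (edges G) λ { (a , a′) _ → cong (λ z → not (π a a′ ∧ z)) (cong₂ _==ᵇ_ (b≗c a) (b≗c a′)) }

  SC⇒ProperOn : ∀ {b} → properOnBlocks b ≡ true → ∀ r → ProperOn G (SC r) b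
  SC⇒ProperOn h r aa′∈ rSCa rSCa′ = properOnBlocks⁻ h r aa′∈ (SC⇒π rSCa) (SC⇒π rSCa′)

  no-proper-colouring : ∀ r → bipartiteOn G (SC r) ≡ false → ∀ b → properOnBlocks b ≡ false
  no-proper-colouring r notBip b with properOnBlocks b in proper
  ... | false = refl
  ... | true = contradiction (trans (sym (bipartiteOn⁺ G (SC r) (toFin2 ∘ b) toFin2-proper)) notBip) λ ()
    where
    toFin2 : Bool → Fin 2
    toFin2 true = zero
    toFin2 false = suc zero
    toFin2-injective : ∀ {x y} → toFin2 x ≡ toFin2 y → x ≡ y
    toFin2-injective {true} {true} _ = refl
    toFin2-injective {false} {false} _ = refl
    toFin2-proper : ProperOn G (SC r) (toFin2 ∘ b)
    toFin2-proper aa′∈ rSCa rSCa′ = SC⇒ProperOn proper r aa′∈ rSCa rSCa′ ∘ toFin2-injective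

  module AllBipartite (bip : allComponentsBipartite G π ≡ true) where

    open Classes SC-equivalence

    twoColouring : (j : Fin classCount) → ∃[ c ] ProperOn G (SC (rep j)) c
    twoColouring j = bipartiteOn⁻ G (SC (rep j)) (all⁻ (λ r → bipartiteOn G (SC r)) bip (∈-lookup {xs = components G π} j))

    colour : Fin classCount → Fin N → Fin 2
    colour j = proj₁ (twoColouring j)

    side : Fin classCount → Fin N → Bool
    side j v = not (colour j v == colour j (rep j))

    side-flip : ∀ j {x v} → colour j x ≢ colour j v → side j v ≡ not (side j x)
    side-flip j {x} {v} cx≢cv = cong not (other (colour j x) (colour j v) (colour j (rep j)) cx≢cv)
      where
      other : (x y z : Fin 2) → x ≢ y → (y == z) ≡ not (x == z)
      other zero zero _ x≢y = contradiction refl x≢y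
      other zero (suc zero) zero _ = refl
      other zero (suc zero) (suc zero) _ = refl
      other (suc zero) zero zero _ = refl
      other (suc zero) zero (suc zero) _ = refl
      other (suc zero) (suc zero) _ x≢y = contradiction refl x≢y

    side-rep : ∀ j → side j (rep j) ≡ false
    side-rep j = cong not (==-refl (colour j (rep j)))

    -- Along a walk inside the block, a block-proper b and the side function both flip at every step.
    proper-colouring-determined : ∀ {b} → properOnBlocks b ≡ true → ∀ j k {v} → Reach (π (rep j)) k (rep j) v →
                                  b v ≡ b (rep j) xor side j v
    proper-colouring-determined {b} proper j zero h with reach-zero⇒≡ h
    ... | refl = sym (trans (cong (b (rep j) xor_) (side-rep j)) (xor-identityʳ (b (rep j))))
    proper-colouring-determined {b} proper j (suc k) {v} h with reach-view h
    ... | shorter h′ = proper-colouring-determined proper j k h′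
    ... | through x rx πv xv = begin
      b v
        ≡⟨ ≢⇒not (ProperOn-adj {G = G} (properOnBlocks⁻ {b} proper (rep j)) xv (reach-target k rx) πv) ⟩
      not (b x)
        ≡⟨ cong not (proper-colouring-determined proper j k rx) ⟩
      not (b (rep j) xor side j x)
        ≡⟨ not-distribʳ-xor (b (rep j)) (side j x) ⟩
      b (rep j) xor not (side j x)
        ≡⟨ cong (b (rep j) xor_) (sym (side-flip j colours-differ)) ⟩
      b (rep j) xor side j v ∎
      where
      open ≡-Reasoning
      colours-differ : colour j x ≢ colour j v
      colours-differ = ProperOn-adj {G = G} (proj₂ (twoColouring j)) xv (SC⁺ k rx) (SC⁺ (suc k) h)
      ≢⇒not : ∀ {p q} → p ≢ q → q ≡ not p
      ≢⇒not {true} {true} p≢q = contradiction refl p≢q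
      ≢⇒not {true} {false} _ = refl
      ≢⇒not {false} {true} _ = refl
      ≢⇒not {false} {false} p≢q = contradiction refl p≢q

    colouringFrom : (Fin classCount → Bool) → Fin N → Bool
    colouringFrom s v = s (classOf v) xor side (classOf v) v

    colouringFrom-rep : ∀ s j → colouringFrom s (rep j) ≡ s j
    colouringFrom-rep s j rewrite classOf-rep j = trans (cong (s j xor_) (side-rep j)) (xor-identityʳ (s j))

    colouringFrom-proper : ∀ s → properOnBlocks (colouringFrom s) ≡ true
    colouringFrom-proper s =
      properOnBlocks⁺ λ {a} {a′} aa′∈ aπa′ → different aa′∈ (classOf-resp (edge⇒SC aa′∈ aπa′))
      where
      different : ∀ {a a′} → (a , a′) ∈ edges G → classOf a ≡ classOf a′ → colouringFrom s a ≢ colouringFrom s a′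
      different {a} {a′} aa′∈ same eq = not-¬ refl (trans eq (begin
        colouringFrom s a′             ≡⟨ cong (λ i → s i xor side i a′) (sym same) ⟩
        s j xor side j a′              ≡⟨ cong (s j xor_) (side-flip j colours-differ) ⟩
        s j xor not (side j a)         ≡⟨ sym (not-distribʳ-xor (s j) (side j a)) ⟩
        not (colouringFrom s a)        ∎))
        where
        open ≡-Reasoning
        j = classOf a
        colours-differ : colour j a ≢ colour j a′
        colours-differ = proj₂ (twoColouring j) aa′∈ (rep-classOf a)
                           (subst (λ i → SC (rep i) a′ ≡ true) (sym same) (rep-classOf a′))

    properOnBlocks-count : ∑[ b ∈ allFuns bools N ] ⟦ properOnBlocks b ⟧ ≡ 2 ^ classCount
    properOnBlocks-count = begin
      ∑[ b ∈ allFuns bools N ] ⟦ properOnBlocks b ⟧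
        ≡⟨ count-bijection (allFuns-isEnumeration _==ᵇ_ bools-isEnumeration N)
                           (allFuns-isEnumeration _==ᵇ_ bools-isEnumeration classCount)
                           (λ b j → b (rep j)) colouringFrom properOnBlocks (λ _ → true)
                           (λ b s → mk⇔ (to b s) (from b s)) ⟩
      ∑[ s ∈ allFuns bools classCount ] 1
        ≡⟨ ∑-one (allFuns bools classCount) ⟩
      length (allFuns bools classCount)
        ≡⟨ length-allFuns bools classCount ⟩
      2 ^ classCount ∎
      where
      open ≡-Reasoning
      to : ∀ b s → pointwiseEq _==ᵇ_ s (λ j → b (rep j)) ∧ properOnBlocks b ≡ true →
           pointwiseEq _==ᵇ_ b (colouringFrom s) ∧ true ≡ true
      to b s h = ∧⁺ (pointwiseEq⁺ _==ᵇ_ λ v → subst (λ z → b v ==ᵇ z ≡ true) (b≡ v) (==ᵇ-refl (b v))) refl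
        where
        b≡ : ∀ v → b v ≡ colouringFrom s v
        b≡ v = trans (proper-colouring-determined (∧⁻ʳ {pointwiseEq _==ᵇ_ s _} h) (classOf v) N (SC⁻ (rep-classOf v)))
                     (cong (_xor side (classOf v) v) (sym (==ᵇ⇒≡ (pointwiseEq⁻ _==ᵇ_ (∧⁻ˡ h) (classOf v)))))
      from : ∀ b s → pointwiseEq _==ᵇ_ b (colouringFrom s) ∧ true ≡ true →
             pointwiseEq _==ᵇ_ s (λ j → b (rep j)) ∧ properOnBlocks b ≡ true
      from b s h = ∧⁺ (pointwiseEq⁺ _==ᵇ_ λ j → subst (λ z → s j ==ᵇ z ≡ true) (sym (s≡ j)) (==ᵇ-refl (s j)))
                      (trans (properOnBlocks-cong b≡) (colouringFrom-proper s))
        where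
        b≡ : ∀ v → b v ≡ colouringFrom s v
        b≡ v = ==ᵇ⇒≡ (pointwiseEq⁻ _==ᵇ_ (∧⁻ˡ h) v)
        s≡ : ∀ j → b (rep j) ≡ s j
        s≡ j = trans (b≡ (rep j)) (colouringFrom-rep s j)

  properOnBlocks-count : ∑[ b ∈ allFuns bools N ] ⟦ properOnBlocks b ⟧ ≡
                         (if allComponentsBipartite G π then 2 ^ length (components G π) else 0)
  properOnBlocks-count with allComponentsBipartite G π in bip
  ... | true = AllBipartite.properOnBlocks-count bip
  ... | false with all-false⁻ _ (components G π) bip
  ... | r , _ , notBip = trans (∑-cong (allFuns bools N) (cong ⟦_⟧ ∘ no-proper-colouring r notBip)) (∑-zero (allFuns bools N))

open DecidableEqualityTest _≟ⁿ_
  using () renaming (_≡?_ to _==ⁿ_; ≡?⇒≡ to ==ⁿ⇒≡; ≡?-refl to ==ⁿ-refl; ≢⇒≡?-false to ≢⇒==ⁿ-false;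
                    ≡?-sym to ==ⁿ-sym)

≡ᵇ-true⇒≡ : {x y : ℕ} → (x ≡ᵇ y) ≡ true → x ≡ y
≡ᵇ-true⇒≡ {x} {y} h = ≡ᵇ⇒≡ x y (Equivalence.from T-≡ h)

≡⇒≡ᵇ-true : {x y : ℕ} → x ≡ y → (x ≡ᵇ y) ≡ true
≡⇒≡ᵇ-true {x} {y} x≡y = Equivalence.to T-≡ (≡⇒≡ᵇ x y x≡y)

≡ᵇ≡==ⁿ : (x y : ℕ) → (x ≡ᵇ y) ≡ (x ==ⁿ y)
≡ᵇ≡==ⁿ x y = ⇔→≡ (mk⇔ (⌊⌋⁺ ∘ ≡ᵇ-true⇒≡) (≡⇒≡ᵇ-true ∘ ==ⁿ⇒≡))

count-∑ : (x : ℕ) (xs : List ℕ) → count x xs ≡ ∑[ y ∈ xs ] ⟦ x ==ⁿ y ⟧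
count-∑ x = length-filter (x ==ⁿ_)

count-∷ : (x y : ℕ) (xs : List ℕ) → count x (y ∷ xs) ≡ ⟦ x ==ⁿ y ⟧ + count x xs
count-∷ x y xs = trans (count-∑ x (y ∷ xs)) (cong (⟦ x ==ⁿ y ⟧ +_) (sym (count-∑ x xs)))

count-tabulate : (x : ℕ) {k : ℕ} (f : Fin k → ℕ) → count x (tabulate f) ≡ ∑[ i ∈ allFin k ] ⟦ x ==ⁿ f i ⟧
count-tabulate x f = begin
  count x (tabulate f)
    ≡⟨ count-∑ x (tabulate f) ⟩
  ∑[ y ∈ tabulate f ] ⟦ x ==ⁿ y ⟧
    ≡⟨ cong (λ ys → ∑ ys (λ y → ⟦ x ==ⁿ y ⟧)) (sym (map-tabulate (λ i → i) f)) ⟩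
  ∑[ y ∈ map f (allFin _) ] ⟦ x ==ⁿ y ⟧
    ≡⟨ ∑-map f (allFin _) _ ⟩
  ∑[ i ∈ allFin _ ] ⟦ x ==ⁿ f i ⟧ ∎
  where open ≡-Reasoning

count≢0⇒∈ : (x : ℕ) (xs : List ℕ) → count x xs ≢ 0 → x ∈ xs
count≢0⇒∈ x [] c≢0 = contradiction refl c≢0
count≢0⇒∈ x (y ∷ xs) c≢0 with x ==ⁿ y in x=y
... | true = here (==ⁿ⇒≡ x=y)
... | false = there (count≢0⇒∈ x xs c≢0)

count-beyond-sum : (y : ℕ) (xs : List ℕ) → sum xs < y → count y xs ≡ 0
count-beyond-sum y [] _ = refl
count-beyond-sum y (x ∷ xs) x+xs<y =
  trans (count-∷ y x xs)
        (cong₂ _+_ (cong ⟦_⟧ (≢⇒==ⁿ-false y≢x)) (count-beyond-sum y xs (≤-trans (s≤s (m≤n+m (sum xs) x)) x+xs<y)))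
  where
  y≢x : y ≢ x
  y≢x refl = <-irrefl refl (≤-trans (s≤s (m≤m+n y (sum xs))) x+xs<y)

sameMultiset-sound : (xs ys : List ℕ) → sameMultiset xs ys ≡ true → ∀ x → count x xs ≡ count x ys
sameMultiset-sound xs ys h x with count x xs in cx | count x ys in cy
... | zero | zero = refl
... | suc a | b =
  trans (sym cx) (trans (≡ᵇ-true⇒≡ (all⁻ _ h (∈-++⁺ˡ (count≢0⇒∈ x xs λ c≡0 → 0≢1+n (trans (sym c≡0) cx))))) cy)
... | zero | suc b =
  trans (sym cx) (trans (≡ᵇ-true⇒≡ (all⁻ _ h (∈-++⁺ʳ xs (count≢0⇒∈ x ys λ c≡0 → 0≢1+n (trans (sym c≡0) cy))))) cy)

sameMultiset-complete : (xs ys : List ℕ) → (∀ x → count x xs ≡ count x ys) → sameMultiset xs ys ≡ true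
sameMultiset-complete xs ys h = all⁺ _ (xs ++ ys) (λ x _ → ≡⇒≡ᵇ-true (h x))

nonzeroParts : List ℕ → List ℕ
nonzeroParts = filter (λ a → not ⌊ a ≟ⁿ 0 ⌋)

count-nonzeroParts : (x : ℕ) (α : List ℕ) → count x (nonzeroParts α) ≡ (if x ==ⁿ 0 then 0 else count x α)
count-nonzeroParts x α = begin
  count x (nonzeroParts α)                               ≡⟨ count-∑ x (nonzeroParts α) ⟩
  ∑[ y ∈ nonzeroParts α ] ⟦ x ==ⁿ y ⟧                    ≡⟨ ∑-filter _ α _ ⟩
  ∑[ a ∈ α ] (⟦ not (a ==ⁿ 0) ⟧ * ⟦ x ==ⁿ a ⟧)           ≡⟨ ∑-cong α term ⟩
  ∑[ a ∈ α ] (if x ==ⁿ 0 then 0 else ⟦ x ==ⁿ a ⟧)        ≡⟨ pull-if ⟩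
  (if x ==ⁿ 0 then 0 else count x α)                    ∎
  where
  open ≡-Reasoning
  term : ∀ a → ⟦ not (a ==ⁿ 0) ⟧ * ⟦ x ==ⁿ a ⟧ ≡ (if x ==ⁿ 0 then 0 else ⟦ x ==ⁿ a ⟧)
  term a with x ==ⁿ 0 in x=0 | a ==ⁿ 0 in a=0
  ... | true | true = refl
  ... | true | false rewrite ==ⁿ⇒≡ x=0 | ==ⁿ-sym 0 a | a=0 = refl
  ... | false | true rewrite ==ⁿ⇒≡ a=0 | x=0 = refl
  ... | false | false = +-identityʳ _
  pull-if : ∑[ a ∈ α ] (if x ==ⁿ 0 then 0 else ⟦ x ==ⁿ a ⟧) ≡ (if x ==ⁿ 0 then 0 else count x α)
  pull-if with x ==ⁿ 0
  ... | true = ∑-zero α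
  ... | false = sym (count-∑ x α)

HasNonzeroParts : List ℕ → List ℕ → Set
HasNonzeroParts α λ′ = ∀ x → 1 ≤ x → count x α ≡ count x λ′

nonzero-≢0 : ∀ {x} → 1 ≤ x → x ==ⁿ 0 ≡ false
nonzero-≢0 {suc x} _ = refl

m-test⇒HasNonzeroParts : (λ′ α : List ℕ) → sameMultiset (nonzeroParts α) λ′ ≡ true → HasNonzeroParts α λ′
m-test⇒HasNonzeroParts λ′ α h x 1≤x =
  trans (sym (trans (count-nonzeroParts x α) (cong (λ b → if b then 0 else count x α) (nonzero-≢0 1≤x))))
        (sameMultiset-sound (nonzeroParts α) λ′ h x)

HasNonzeroParts⇒m-test : (λ′ α : List ℕ) → count 0 λ′ ≡ 0 → HasNonzeroParts α λ′ →
                         sameMultiset (nonzeroParts α) λ′ ≡ true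
HasNonzeroParts⇒m-test λ′ α noZero parts = sameMultiset-complete (nonzeroParts α) λ′ same
  where
  same : ∀ x → count x (nonzeroParts α) ≡ count x λ′
  same zero = trans (count-nonzeroParts 0 α) (sym noZero)
  same (suc x) = trans (count-nonzeroParts (suc x) α) (parts (suc x) (s≤s z≤n))

∏< : ℕ → (ℕ → ℕ) → ℕ
∏< N g = product (applyUpTo g N)

∏<-cong : (N : ℕ) {g h : ℕ → ℕ} → (∀ i → g i ≡ h i) → ∏< N g ≡ ∏< N h
∏<-cong zero g≗h = refl
∏<-cong (suc N) g≗h = cong₂ _*_ (g≗h 0) (∏<-cong N (g≗h ∘ suc))

∏<-ones : (N : ℕ) (g : ℕ → ℕ) → (∀ i → g i ≡ 1) → ∏< N g ≡ 1
∏<-ones zero g ones = refl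
∏<-ones (suc N) g ones rewrite ones 0 = trans (+-identityʳ _) (∏<-ones N (g ∘ suc) (ones ∘ suc))

∏<-extend : (M N : ℕ) (g : ℕ → ℕ) → (∀ i → M ≤ i → g i ≡ 1) → M ≤ N → ∏< N g ≡ ∏< M g
∏<-extend zero N g ones _ = ∏<-ones N g (λ i → ones i z≤n)
∏<-extend (suc M) (suc N) g ones (s≤s M≤N) =
  cong (g 0 *_) (∏<-extend M N (g ∘ suc) (λ i M≤i → ones (suc i) (s≤s M≤i)) M≤N)

∏<-update : (N j m : ℕ) (g g′ : ℕ → ℕ) → (∀ i → i ≢ j → g′ i ≡ g i) → g′ j ≡ m * g j → j < N →
            ∏< N g′ ≡ m * ∏< N g
∏<-update (suc N) zero m g g′ same changed _ = begin
  g′ 0 * ∏< N (g′ ∘ suc)  ≡⟨ cong₂ _*_ changed (∏<-cong N (λ i → same (suc i) λ ())) ⟩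
  m * g 0 * ∏< N (g ∘ suc) ≡⟨ *-assoc m (g 0) _ ⟩
  m * (g 0 * ∏< N (g ∘ suc)) ∎
  where open ≡-Reasoning
∏<-update (suc N) (suc j) m g g′ same changed (s≤s j<N) = begin
  g′ 0 * ∏< N (g′ ∘ suc)
    ≡⟨ cong₂ _*_ (same 0 λ ())
                 (∏<-update N j m (g ∘ suc) (g′ ∘ suc) (λ i i≢j → same (suc i) (i≢j ∘ suc-injective)) changed j<N) ⟩
  g 0 * (m * ∏< N (g ∘ suc))
    ≡⟨ x∙yz≈y∙xz (g 0) m _ ⟩
  m * (g 0 * ∏< N (g ∘ suc)) ∎
  where
  open ≡-Reasoning
  open import Algebra.Properties.CommutativeSemigroup *-commutativeSemigroup using (x∙yz≈y∙xz)

map-applyUpTo : (g f : ℕ → ℕ) (N : ℕ) → map g (applyUpTo f N) ≡ applyUpTo (g ∘ f) N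
map-applyUpTo g f zero = refl
map-applyUpTo g f (suc N) = cong (g (f 0) ∷_) (map-applyUpTo g (f ∘ suc) N)

multFactorial-∏< : (l : List ℕ) → multFactorial l ≡ ∏< (sum l) (λ i → count (suc i) l !)
multFactorial-∏< l = cong product (map-applyUpTo (λ i → count (suc i) l !) (λ i → i) (sum l))

-- Prepending a part w changes only the factor r_w!, which becomes (r_w + 1)!.
multFactorial-∷ : (w : ℕ) (l : List ℕ) → 1 ≤ w → multFactorial (w ∷ l) ≡ suc (count w l) * multFactorial l
multFactorial-∷ (suc j) l _ = begin
  multFactorial (suc j ∷ l)
    ≡⟨ multFactorial-∏< (suc j ∷ l) ⟩
  ∏< (suc j + sum l) g′
    ≡⟨ ∏<-update (suc j + sum l) j (suc (count (suc j) l)) g g′ same changed (s≤s (m≤m+n j (sum l))) ⟩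
  suc (count (suc j) l) * ∏< (suc j + sum l) g
    ≡⟨ cong (suc (count (suc j) l) *_) (∏<-extend (sum l) (suc j + sum l) g beyond (m≤n+m (sum l) (suc j))) ⟩
  suc (count (suc j) l) * ∏< (sum l) g
    ≡⟨ cong (suc (count (suc j) l) *_) (sym (multFactorial-∏< l)) ⟩
  suc (count (suc j) l) * multFactorial l ∎
  where
  open ≡-Reasoning
  g g′ : ℕ → ℕ
  g i = count (suc i) l !
  g′ i = count (suc i) (suc j ∷ l) !
  same : ∀ i → i ≢ j → g′ i ≡ g i
  same i i≢j = cong _! (trans (count-∷ (suc i) (suc j) l)
                              (cong (λ b → ⟦ b ⟧ + count (suc i) l) (≢⇒==ⁿ-false (i≢j ∘ suc-injective))))
  changed : g′ j ≡ suc (count (suc j) l) * g j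
  changed = cong _! (trans (count-∷ (suc j) (suc j) l) (cong (λ b → ⟦ b ⟧ + count (suc j) l) (==ⁿ-refl (suc j))))
  beyond : ∀ i → sum l ≤ i → g i ≡ 1
  beyond i sum≤i = cong _! (count-beyond-sum (suc i) l (s≤s sum≤i))

zeroAt : {k : ℕ} → (Fin k → ℕ) → Fin k → Fin k → ℕ
zeroAt α a i = if i == a then 0 else α i

count-zeroAt : {k : ℕ} (α : Fin k → ℕ) (a : Fin k) (x : ℕ) → 1 ≤ x →
               count x (tabulate α) ≡ count x (tabulate (zeroAt α a)) + ⟦ x ==ⁿ α a ⟧
count-zeroAt {k} α a x 1≤x = begin
  count x (tabulate α)
    ≡⟨ count-tabulate x α ⟩
  ∑[ i ∈ allFin k ] ⟦ x ==ⁿ α i ⟧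
    ≡⟨ ∑-cong (allFin k) split ⟩
  ∑[ i ∈ allFin k ] (⟦ x ==ⁿ zeroAt α a i ⟧ + ⟦ i == a ⟧ * ⟦ x ==ⁿ α a ⟧)
    ≡⟨ ∑-distrib-+ (allFin k) _ _ ⟩
  ∑[ i ∈ allFin k ] ⟦ x ==ⁿ zeroAt α a i ⟧ + ∑[ i ∈ allFin k ] (⟦ i == a ⟧ * ⟦ x ==ⁿ α a ⟧)
    ≡⟨ cong₂ _+_ (sym (count-tabulate x (zeroAt α a)))
                 (∑-indicator-delta (allFin-isEnumeration k) a (λ _ → ⟦ x ==ⁿ α a ⟧) (λ _ _ → refl)) ⟩
  count x (tabulate (zeroAt α a)) + ⟦ x ==ⁿ α a ⟧
    ∎
  where
  open ≡-Reasoning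
  split : ∀ i → ⟦ x ==ⁿ α i ⟧ ≡ ⟦ x ==ⁿ zeroAt α a i ⟧ + ⟦ i == a ⟧ * ⟦ x ==ⁿ α a ⟧
  split i with i == a in i=a
  ... | true rewrite ==⇒≡ i=a | nonzero-≢0 1≤x = sym (+-identityʳ _)
  ... | false = sym (+-identityʳ _)

module _ (w : ℕ) (l : List ℕ) {k : ℕ} (α : Fin k → ℕ) (a : Fin k) (αa≡w : α a ≡ w) where

  private
    count-w∷l : ∀ x → count x (w ∷ l) ≡ count x l + ⟦ x ==ⁿ w ⟧
    count-w∷l x = trans (count-∷ x w l) (+-comm _ (count x l))

  HasNonzeroParts-remove : HasNonzeroParts (tabulate α) (w ∷ l) → HasNonzeroParts (tabulate (zeroAt α a)) l
  HasNonzeroParts-remove parts x 1≤x = +-cancelʳ-≡ _ _ _ (begin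
    count x (tabulate (zeroAt α a)) + ⟦ x ==ⁿ w ⟧   ≡⟨ cong (λ z → _ + ⟦ x ==ⁿ z ⟧) (sym αa≡w) ⟩
    count x (tabulate (zeroAt α a)) + ⟦ x ==ⁿ α a ⟧ ≡⟨ sym (count-zeroAt α a x 1≤x) ⟩
    count x (tabulate α)                           ≡⟨ parts x 1≤x ⟩
    count x (w ∷ l)                                ≡⟨ count-w∷l x ⟩
    count x l + ⟦ x ==ⁿ w ⟧                        ∎)
    where open ≡-Reasoning

  HasNonzeroParts-insert : HasNonzeroParts (tabulate (zeroAt α a)) l → HasNonzeroParts (tabulate α) (w ∷ l)
  HasNonzeroParts-insert parts x 1≤x = begin
    count x (tabulate α)
      ≡⟨ count-zeroAt α a x 1≤x ⟩
    count x (tabulate (zeroAt α a)) + ⟦ x ==ⁿ α a ⟧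
      ≡⟨ cong₂ _+_ (parts x 1≤x) (cong (λ z → ⟦ x ==ⁿ z ⟧) αa≡w) ⟩
    count x l + ⟦ x ==ⁿ w ⟧
      ≡⟨ sym (count-w∷l x) ⟩
    count x (w ∷ l) ∎
    where open ≡-Reasoning

-- Expand along the position a that carries the part w; there are r_w(w ∷ l) such positions.
m̃-coeff-∷ : (w : ℕ) (l : List ℕ) → 1 ≤ w → count 0 l ≡ 0 → {k : ℕ} (α : Fin k → ℕ) →
            m̃-coeff (w ∷ l) (tabulate α) ≡ ∑[ a ∈ allFin k ] (⟦ α a ≡ᵇ w ⟧ * m̃-coeff l (tabulate (zeroAt α a)))
m̃-coeff-∷ w l 1≤w noZero {k} α with sameMultiset (nonzeroParts (tabulate α)) (w ∷ l) in test
... | true = begin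
  multFactorial (w ∷ l) * 1
    ≡⟨ *-identityʳ _ ⟩
  multFactorial (w ∷ l)
    ≡⟨ multFactorial-∷ w l 1≤w ⟩
  suc (count w l) * multFactorial l
    ≡⟨ cong (_* multFactorial l) (sym positions) ⟩
  ∑[ a ∈ allFin k ] ⟦ α a ≡ᵇ w ⟧ * multFactorial l
    ≡⟨ sym (*-distribʳ-∑ (multFactorial l) (allFin k) _) ⟩
  ∑[ a ∈ allFin k ] (⟦ α a ≡ᵇ w ⟧ * multFactorial l)
    ≡⟨ ∑-cong (allFin k) term ⟩
  ∑[ a ∈ allFin k ] (⟦ α a ≡ᵇ w ⟧ * m̃-coeff l (tabulate (zeroAt α a))) ∎
  where
  open ≡-Reasoning
  parts = m-test⇒HasNonzeroParts (w ∷ l) (tabulate α) test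
  positions : ∑[ a ∈ allFin k ] ⟦ α a ≡ᵇ w ⟧ ≡ suc (count w l)
  positions = begin
    ∑[ a ∈ allFin k ] ⟦ α a ≡ᵇ w ⟧
      ≡⟨ ∑-cong (allFin k) (λ a → cong ⟦_⟧ (trans (≡ᵇ≡==ⁿ (α a) w) (==ⁿ-sym (α a) w))) ⟩
    ∑[ a ∈ allFin k ] ⟦ w ==ⁿ α a ⟧
      ≡⟨ sym (count-tabulate w α) ⟩
    count w (tabulate α)
      ≡⟨ parts w 1≤w ⟩
    count w (w ∷ l)
      ≡⟨ count-∷ w w l ⟩
    ⟦ w ==ⁿ w ⟧ + count w l
      ≡⟨ cong (λ b → ⟦ b ⟧ + count w l) (==ⁿ-refl w) ⟩
    suc (count w l) ∎
  term : ∀ a → ⟦ α a ≡ᵇ w ⟧ * multFactorial l ≡ ⟦ α a ≡ᵇ w ⟧ * m̃-coeff l (tabulate (zeroAt α a))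
  term a with α a ≡ᵇ w in αa=w
  ... | false = refl
  ... | true rewrite HasNonzeroParts⇒m-test l (tabulate (zeroAt α a)) noZero
                       (HasNonzeroParts-remove w l α a (≡ᵇ-true⇒≡ αa=w) parts) = cong (_+ 0) (sym (*-identityʳ _))
... | false = trans (*-zeroʳ (multFactorial (w ∷ l))) (sym (trans (∑-cong (allFin k) term) (∑-zero (allFin k))))
  where
  term : ∀ a → ⟦ α a ≡ᵇ w ⟧ * m̃-coeff l (tabulate (zeroAt α a)) ≡ 0
  term a with α a ≡ᵇ w in αa=w
  ... | false = refl
  ... | true with sameMultiset (nonzeroParts (tabulate (zeroAt α a))) l in test′
  ... | false = trans (+-identityʳ _) (*-zeroʳ (multFactorial l))
  ... | true = contradiction (trans (sym (HasNonzeroParts⇒m-test (w ∷ l) (tabulate α) noZero′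
                 (HasNonzeroParts-insert w l α a (≡ᵇ-true⇒≡ αa=w) (m-test⇒HasNonzeroParts l (tabulate (zeroAt α a)) test′)))) test) λ ()
    where
    noZero′ : count 0 (w ∷ l) ≡ 0
    noZero′ = trans (count-∷ 0 w l) (cong₂ _+_ (cong ⟦_⟧ (trans (==ⁿ-sym 0 w) (nonzero-≢0 1≤w))) noZero)

avoids : {c k : ℕ} → Fin k → (Fin c → Fin k) → Bool
avoids {c} a f = all (λ j → not (f j == a)) (allFin c)

injectiveᵇ : {c k : ℕ} → (Fin c → Fin k) → Bool
injectiveᵇ {zero} φ = true
injectiveᵇ {suc c} φ = avoids (φ zero) (φ ∘ suc) ∧ injectiveᵇ (φ ∘ suc)

load : {c k : ℕ} → (Fin c → Fin k) → (Fin c → ℕ) → Fin k → ℕ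
load {c} φ W i = ∑[ j ∈ allFin c ] (⟦ φ j == i ⟧ * W j)

hasLoads : {c k : ℕ} → (Fin c → ℕ) → (Fin k → ℕ) → (Fin c → Fin k) → Bool
hasLoads {k = k} W α φ = all (λ i → load φ W i ≡ᵇ α i) (allFin k)

module _ {c k : ℕ} {W : Fin c → ℕ} {α : Fin k → ℕ} {φ : Fin c → Fin k} where

  hasLoads⁻ : hasLoads W α φ ≡ true → ∀ i → load φ W i ≡ α i
  hasLoads⁻ h i = ≡ᵇ-true⇒≡ (all-allFin⁻ (λ i → load φ W i ≡ᵇ α i) h i)

  hasLoads⁺ : (∀ i → load φ W i ≡ α i) → hasLoads W α φ ≡ true
  hasLoads⁺ h = all-allFin⁺ (λ i → load φ W i ≡ᵇ α i) (λ i → ≡⇒≡ᵇ-true (h i))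

avoids⁻ : {c k : ℕ} {a : Fin k} {f : Fin c → Fin k} → avoids a f ≡ true → ∀ j → f j ≢ a
avoids⁻ {a = a} h j fj≡a = contradiction (trans (sym (==-refl a)) (trans (cong (_== a) (sym fj≡a)) (not⁻ (all-allFin⁻ _ h j)))) λ ()

injectiveᵇ-sound : {c k : ℕ} (φ : Fin c → Fin k) → injectiveᵇ φ ≡ true → ∀ i j → φ i ≡ φ j → i ≡ j
injectiveᵇ-sound {suc c} φ h zero zero _ = refl
injectiveᵇ-sound {suc c} φ h zero (suc j) φ0≡φj = contradiction (sym φ0≡φj) (avoids⁻ (∧⁻ˡ h) j)
injectiveᵇ-sound {suc c} φ h (suc i) zero φi≡φ0 = contradiction φi≡φ0 (avoids⁻ (∧⁻ˡ h) i)
injectiveᵇ-sound {suc c} φ h (suc i) (suc j) φi≡φj =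
  cong suc (injectiveᵇ-sound (φ ∘ suc) (∧⁻ʳ {avoids (φ zero) (φ ∘ suc)} h) i j φi≡φj)

injectiveᵇ-complete : {c k : ℕ} (φ : Fin c → Fin k) → (∀ i j → φ i ≡ φ j → i ≡ j) → injectiveᵇ φ ≡ true
injectiveᵇ-complete {zero} φ inj = refl
injectiveᵇ-complete {suc c} φ inj =
  ∧⁺ (all-allFin⁺ _ λ j → not⁺ (≢⇒==-false λ φj≡φ0 → contradiction (inj (suc j) zero φj≡φ0) λ ()))
     (injectiveᵇ-complete (φ ∘ suc) λ i j φi≡φj → Fin-suc-injective (inj (suc i) (suc j) φi≡φj))

load-suc : {c k : ℕ} (φ : Fin (suc c) → Fin k) (W : Fin (suc c) → ℕ) (i : Fin k) →
           load φ W i ≡ ⟦ φ zero == i ⟧ * W zero + load (φ ∘ suc) (W ∘ suc) i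
load-suc {c} φ W i = ∑-allFin-suc c (λ j → ⟦ φ j == i ⟧ * W j)

load-avoided : {c k : ℕ} (φ : Fin c → Fin k) (W : Fin c → ℕ) (a : Fin k) → avoids a φ ≡ true → load φ W a ≡ 0
load-avoided {c} φ W a h =
  trans (∑-cong (allFin c) (λ j → cong (λ b → ⟦ b ⟧ * W j) (not⁻ (all-allFin⁻ _ h j)))) (∑-zero (allFin c))

load-zero⇒avoids : {c k : ℕ} (φ : Fin c → Fin k) (W : Fin c → ℕ) (a : Fin k) → (∀ j → 1 ≤ W j) →
                   load φ W a ≡ 0 → avoids a φ ≡ true
load-zero⇒avoids {c} φ W a pos h = all-allFin⁺ _ λ j → not⁺ (hit j)
  where
  hit : ∀ j → (φ j == a) ≡ false
  hit j with φ j == a in φj=a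
  ... | false = refl
  ... | true = contradiction (≤-trans (pos j) Wj≤0) λ ()
    where
    Wj≤0 : W j ≤ 0
    Wj≤0 = subst₂ _≤_ (trans (cong (λ b → ⟦ b ⟧ * W j) φj=a) (+-identityʳ (W j))) h
                      (≤-∑ (λ j → ⟦ φ j == a ⟧ * W j) (∈-allFin j))

module PlacementStep {c k : ℕ} (W : Fin (suc c) → ℕ) (α : Fin k → ℕ) (φ : Fin (suc c) → Fin k) where

  private
    a = φ zero
    φ′ = φ ∘ suc
    W′ = W ∘ suc

  load-first : load φ W a ≡ W zero + load φ′ W′ a
  load-first = trans (load-suc φ W a)
    (cong (_+ load φ′ W′ a) (trans (cong (λ b → ⟦ b ⟧ * W zero) (==-refl a)) (+-identityʳ (W zero))))

  load-other : ∀ i → (i == a) ≡ false → load φ W i ≡ load φ′ W′ i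
  load-other i i≠a = trans (load-suc φ W i) (cong (λ b → ⟦ b ⟧ * W zero + load φ′ W′ i) (trans (==-sym a i) i≠a))

  split : (avoids a φ′ ∧ injectiveᵇ φ′) ∧ hasLoads W α φ ≡ true →
          (α a ≡ᵇ W zero) ∧ (injectiveᵇ φ′ ∧ hasLoads W′ (zeroAt α a) φ′) ≡ true
  split h = ∧⁺ (≡⇒≡ᵇ-true (sym W0≡αa)) (∧⁺ (∧⁻ʳ {avoids a φ′} (∧⁻ˡ h)) (hasLoads⁺ {φ = φ′} loads′))
    where
    loads = hasLoads⁻ {φ = φ} (∧⁻ʳ {avoids a φ′ ∧ injectiveᵇ φ′} h)
    empty : load φ′ W′ a ≡ 0
    empty = load-avoided φ′ W′ a (∧⁻ˡ (∧⁻ˡ h))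
    W0≡αa : W zero ≡ α a
    W0≡αa = trans (sym (trans (cong (W zero +_) empty) (+-identityʳ (W zero)))) (trans (sym load-first) (loads a))
    loads′ : ∀ i → load φ′ W′ i ≡ zeroAt α a i
    loads′ i with i == a in i=a
    ... | true rewrite ==⇒≡ i=a = empty
    ... | false = trans (sym (load-other i i=a)) (loads i)

  join : (∀ j → 1 ≤ W j) → (α a ≡ᵇ W zero) ∧ (injectiveᵇ φ′ ∧ hasLoads W′ (zeroAt α a) φ′) ≡ true →
         (avoids a φ′ ∧ injectiveᵇ φ′) ∧ hasLoads W α φ ≡ true
  join pos h = ∧⁺ (∧⁺ (load-zero⇒avoids φ′ W′ a (pos ∘ suc) empty) (∧⁻ˡ rest)) (hasLoads⁺ {φ = φ} loads)
    where
    rest = ∧⁻ʳ {α a ≡ᵇ W zero} h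
    loads′ = hasLoads⁻ {φ = φ′} (∧⁻ʳ {injectiveᵇ φ′} rest)
    empty : load φ′ W′ a ≡ 0
    empty = trans (loads′ a) (cong (λ b → if b then 0 else α a) (==-refl a))
    loads : ∀ i → load φ W i ≡ α i
    loads i with i == a in i=a
    ... | true rewrite ==⇒≡ i=a =
      trans load-first (trans (cong (W zero +_) empty) (trans (+-identityʳ (W zero)) (sym (≡ᵇ-true⇒≡ (∧⁻ˡ h)))))
    ... | false = trans (load-other i i=a) (trans (loads′ i) (cong (λ b → if b then 0 else α i) i=a))

placement-step : {c k : ℕ} (W : Fin (suc c) → ℕ) (α : Fin k → ℕ) → (∀ j → 1 ≤ W j) → (φ : Fin (suc c) → Fin k) →
  ⟦ injectiveᵇ φ ∧ hasLoads W α φ ⟧ ≡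
  ⟦ α (φ zero) ≡ᵇ W zero ⟧ * ⟦ injectiveᵇ (φ ∘ suc) ∧ hasLoads (W ∘ suc) (zeroAt α (φ zero)) (φ ∘ suc) ⟧
placement-step W α pos φ = trans (⟦⟧-cong-⇔ split (join pos)) (⟦∧⟧ (α (φ zero) ≡ᵇ W zero) _)
  where open PlacementStep W α φ

count-zero-positive : {c : ℕ} (W : Fin c → ℕ) → (∀ j → 1 ≤ W j) → count 0 (tabulate W) ≡ 0
count-zero-positive {c} W pos =
  trans (count-tabulate 0 W)
        (trans (∑-cong (allFin c) (λ j → cong ⟦_⟧ (trans (==ⁿ-sym 0 (W j)) (nonzero-≢0 (pos j))))) (∑-zero (allFin c)))

no-nonzero-parts : {k : ℕ} (α : Fin k → ℕ) → HasNonzeroParts (tabulate α) [] → ∀ i → α i ≡ 0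
no-nonzero-parts {k} α parts i with α i in αi
... | zero = refl
... | suc y = contradiction (≤-trans present (≤-reflexive (parts (suc y) (s≤s z≤n)))) λ ()
  where
  present : 1 ≤ count (suc y) (tabulate α)
  present = subst (1 ≤_) (sym (count-tabulate (suc y) α))
              (subst (_≤ _) (trans (cong (λ z → ⟦ suc y ==ⁿ z ⟧) αi) (cong ⟦_⟧ (==ⁿ-refl (suc y))))
                 (≤-∑ (λ i → ⟦ suc y ==ⁿ α i ⟧) (∈-allFin i)))

all-zero⇒HasNonzeroParts : {k : ℕ} (α : Fin k → ℕ) → (∀ i → α i ≡ 0) → HasNonzeroParts (tabulate α) []
all-zero⇒HasNonzeroParts {k} α zeros x 1≤x =
  trans (count-tabulate x α)
        (trans (∑-cong (allFin k) (λ i → trans (cong (λ z → ⟦ x ==ⁿ z ⟧) (zeros i)) (cong ⟦_⟧ (nonzero-≢0 1≤x))))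
               (∑-zero (allFin k)))

injective-placements-count : (c k : ℕ) (W : Fin c → ℕ) (α : Fin k → ℕ) → (∀ j → 1 ≤ W j) →
  ∑[ φ ∈ allFuns (allFin k) c ] ⟦ injectiveᵇ φ ∧ hasLoads W α φ ⟧ ≡ m̃-coeff (tabulate W) (tabulate α)
injective-placements-count zero k W α pos =
  trans (+-identityʳ _) (trans (⟦⟧-cong-⇔ to from) (sym (trans (+-identityʳ _) (m-coeff≡⟦⟧ _))))
  where
  m-coeff≡⟦⟧ : ∀ b → (if b then 1 else 0) ≡ ⟦ b ⟧
  m-coeff≡⟦⟧ true = refl
  m-coeff≡⟦⟧ false = refl
  to : hasLoads W α (λ ()) ≡ true → sameMultiset (nonzeroParts (tabulate α)) [] ≡ true
  to h = HasNonzeroParts⇒m-test [] (tabulate α) refl (all-zero⇒HasNonzeroParts α (sym ∘ hasLoads⁻ {W = W} {φ = λ ()} h))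
  from : sameMultiset (nonzeroParts (tabulate α)) [] ≡ true → hasLoads W α (λ ()) ≡ true
  from h = hasLoads⁺ {W = W} {φ = λ ()} (sym ∘ no-nonzero-parts α (m-test⇒HasNonzeroParts [] (tabulate α) h))
injective-placements-count (suc c) k W α pos = begin
  ∑[ φ ∈ allFuns (allFin k) (suc c) ] ⟦ injectiveᵇ φ ∧ hasLoads W α φ ⟧
    ≡⟨ ∑-allFuns-suc (allFin k) c _ (λ a φ′ → ⟦ α a ≡ᵇ W zero ⟧ * rest a φ′) (placement-step W α pos) ⟩
  ∑[ a ∈ allFin k ] ∑[ φ′ ∈ allFuns (allFin k) c ] (⟦ α a ≡ᵇ W zero ⟧ * rest a φ′)
    ≡⟨ ∑-cong (allFin k) (λ a → *-distribˡ-∑ ⟦ α a ≡ᵇ W zero ⟧ (allFuns (allFin k) c) (rest a)) ⟩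
  ∑[ a ∈ allFin k ] (⟦ α a ≡ᵇ W zero ⟧ * ∑[ φ′ ∈ allFuns (allFin k) c ] rest a φ′)
    ≡⟨ ∑-cong (allFin k) (λ a → cong (⟦ α a ≡ᵇ W zero ⟧ *_)
                                     (injective-placements-count c k (W ∘ suc) (zeroAt α a) (pos ∘ suc))) ⟩
  ∑[ a ∈ allFin k ] (⟦ α a ≡ᵇ W zero ⟧ * m̃-coeff (tabulate (W ∘ suc)) (tabulate (zeroAt α a)))
    ≡⟨ sym (m̃-coeff-∷ (W zero) (tabulate (W ∘ suc)) (pos zero) (count-zero-positive (W ∘ suc) (pos ∘ suc)) α) ⟩
  m̃-coeff (tabulate W) (tabulate α) ∎
  where
  open ≡-Reasoning
  rest : Fin k → (Fin c → Fin k) → ℕ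
  rest a φ′ = ⟦ injectiveᵇ φ′ ∧ hasLoads (W ∘ suc) (zeroAt α a) φ′ ⟧

hasMonomialᵏ : (G : WGraph) (α : List ℕ) → (Fin (n G) → Fin (length α)) → Bool
hasMonomialᵏ G α ℓ = hasMonomial G (λ c → c) ℓ (lookup α)

module BlockColourings (G : WGraph) (pos : PositiveWeights G) {π : Rel (n G)} (E : EquivalenceRel π) (α : List ℕ) where

  open EquivalenceRel E
  open Classes E

  private
    N = n G
    k = length α
    w = weight G

  blockWeight : Fin N → ℕ
  blockWeight r = ∑[ u ∈ allFin N ] (if π r u then w u else 0)

  W : Fin classCount → ℕ
  W j = blockWeight (rep j)

  W-positive : ∀ j → 1 ≤ W j
  W-positive j = ≤-trans (pos (rep j))
    (subst (_≤ W j) (cong (λ b → if b then w (rep j) else 0) (reflexive (rep j)))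
      (≤-∑ (λ u → if π (rep j) u then w u else 0) (∈-allFin (rep j))))

  if≡⟦⟧* : ∀ b m → (if b then m else 0) ≡ ⟦ b ⟧ * m
  if≡⟦⟧* true m = sym (+-identityʳ m)
  if≡⟦⟧* false m = refl

  expo≡load : (ℓ : Fin N → Fin k) (φ : Fin classCount → Fin k) → (∀ v → ℓ v ≡ φ (classOf v)) →
              ∀ i → expo G (λ c → c) ℓ i ≡ load φ W i
  expo≡load ℓ φ ℓ≡φ i = begin
    expo G (λ c → c) ℓ i
      ≡⟨ ∑-cong (allFin N) (λ v → if≡⟦⟧* (ℓ v == i) (w v)) ⟩
    ∑[ v ∈ allFin N ] (⟦ ℓ v == i ⟧ * w v)
      ≡⟨ ∑-cong (allFin N) (λ v → sym (single-block v)) ⟩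
    ∑[ v ∈ allFin N ] ∑[ j ∈ allFin classCount ] (⟦ φ j == i ⟧ * (if π (rep j) v then w v else 0))
      ≡⟨ ∑-comm (allFin N) (allFin classCount) _ ⟩
    ∑[ j ∈ allFin classCount ] ∑[ v ∈ allFin N ] (⟦ φ j == i ⟧ * (if π (rep j) v then w v else 0))
      ≡⟨ ∑-cong (allFin classCount) (λ j → *-distribˡ-∑ ⟦ φ j == i ⟧ (allFin N) _) ⟩
    load φ W i ∎
    where
    open ≡-Reasoning
    in-block : ∀ v j → ⟦ φ j == i ⟧ * (if π (rep j) v then w v else 0) ≡ ⟦ j == classOf v ⟧ * (⟦ φ j == i ⟧ * w v)
    in-block v j with π (rep j) v in repπv
    ... | true rewrite classOf-unique v j repπv | ==-refl j = sym (+-identityʳ _)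
    ... | false with j == classOf v in j=class
    ... | false = *-zeroʳ ⟦ φ j == i ⟧
    ... | true = contradiction (trans (sym (subst (λ z → π (rep z) v ≡ true) (sym (==⇒≡ j=class)) (rep-classOf v))) repπv) λ ()
    single-block : ∀ v → ∑[ j ∈ allFin classCount ] (⟦ φ j == i ⟧ * (if π (rep j) v then w v else 0)) ≡
                         ⟦ ℓ v == i ⟧ * w v
    single-block v = begin
      ∑[ j ∈ allFin classCount ] (⟦ φ j == i ⟧ * (if π (rep j) v then w v else 0))
        ≡⟨ ∑-cong (allFin classCount) (in-block v) ⟩
      ∑[ j ∈ allFin classCount ] (⟦ j == classOf v ⟧ * (⟦ φ j == i ⟧ * w v))
        ≡⟨ ∑-indicator-delta (allFin-isEnumeration classCount) (classOf v) (λ j → ⟦ φ j == i ⟧ * w v)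
             (λ j j=class → cong (λ z → ⟦ φ z == i ⟧ * w v) (==⇒≡ j=class)) ⟩
      ⟦ φ (classOf v) == i ⟧ * w v
        ≡⟨ cong (λ z → ⟦ z == i ⟧ * w v) (sym (ℓ≡φ v)) ⟩
      ⟦ ℓ v == i ⟧ * w v ∎

  hasMonomial≡hasLoads : (ℓ : Fin N → Fin k) (φ : Fin classCount → Fin k) → (∀ v → ℓ v ≡ φ (classOf v)) →
                         hasMonomialᵏ G α ℓ ≡ hasLoads W (lookup α) φ
  hasMonomial≡hasLoads ℓ φ ℓ≡φ = all-allFin-cong λ i → cong (_≡ᵇ lookup α i) (expo≡load ℓ φ ℓ≡φ i)

  kernelTest : (Fin N → Fin k) → Bool
  kernelTest ℓ = relEq π (kernel ℓ) ∧ hasMonomialᵏ G α ℓ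

  placementTest : (Fin classCount → Fin k) → Bool
  placementTest φ = injectiveᵇ φ ∧ hasLoads W (lookup α) φ

  kernel⇒placement : (ℓ : Fin N → Fin k) (φ : Fin classCount → Fin k) →
                     pointwiseEq _==_ φ (λ j → ℓ (rep j)) ∧ kernelTest ℓ ≡ true →
                     pointwiseEq _==_ ℓ (λ v → φ (classOf v)) ∧ placementTest φ ≡ true
  kernel⇒placement ℓ φ h = ∧⁺ (pointwiseEq⁺ _==_ λ v → subst (λ z → ℓ v == z ≡ true) (ℓ≡φ v) (==-refl (ℓ v)))
                              (∧⁺ (injectiveᵇ-complete φ injective) (trans (sym (hasMonomial≡hasLoads ℓ φ ℓ≡φ)) (∧⁻ʳ {relEq π (kernel ℓ)} rest)))
    where
    rest = ∧⁻ʳ {pointwiseEq _==_ φ (λ j → ℓ (rep j))} h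
    π≐kernel = ∧⁻ˡ rest
    φ≡ : ∀ j → φ j ≡ ℓ (rep j)
    φ≡ j = ==⇒≡ (pointwiseEq⁻ _==_ (∧⁻ˡ h) j)
    ℓ≡φ : ∀ v → ℓ v ≡ φ (classOf v)
    ℓ≡φ v = trans (sym (==⇒≡ (trans (sym (relEq⁻ π≐kernel (rep (classOf v)) v)) (rep-classOf v)))) (sym (φ≡ (classOf v)))
    injective : ∀ i j → φ i ≡ φ j → i ≡ j
    injective i j φi≡φj = rep-injective i j
      (trans (relEq⁻ π≐kernel (rep i) (rep j)) (⌊⌋⁺ (trans (sym (φ≡ i)) (trans φi≡φj (φ≡ j)))))

  placement⇒kernel : (ℓ : Fin N → Fin k) (φ : Fin classCount → Fin k) →
                     pointwiseEq _==_ ℓ (λ v → φ (classOf v)) ∧ placementTest φ ≡ true →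
                     pointwiseEq _==_ φ (λ j → ℓ (rep j)) ∧ kernelTest ℓ ≡ true
  placement⇒kernel ℓ φ h = ∧⁺ (pointwiseEq⁺ _==_ λ j → subst (λ z → φ j == z ≡ true) (φ≡ j) (==-refl (φ j)))
                              (∧⁺ (relEq⁺ π≡kernel) (trans (hasMonomial≡hasLoads ℓ φ ℓ≡φ) (∧⁻ʳ {injectiveᵇ φ} rest)))
    where
    ℓ≡φ : ∀ v → ℓ v ≡ φ (classOf v)
    ℓ≡φ v = ==⇒≡ (pointwiseEq⁻ _==_ (∧⁻ˡ h) v)
    rest = ∧⁻ʳ {pointwiseEq _==_ ℓ (λ v → φ (classOf v))} h
    injective = injectiveᵇ-sound φ (∧⁻ˡ rest)
    φ≡ : ∀ j → φ j ≡ ℓ (rep j)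
    φ≡ j = trans (cong φ (sym (classOf-rep j))) (sym (ℓ≡φ (rep j)))
    π≡kernel : ∀ u v → π u v ≡ kernel ℓ u v
    π≡kernel u v with π u v in uπv | ℓ u == ℓ v in ℓu=ℓv
    ... | true | true = refl
    ... | false | false = refl
    ... | true | false = contradiction (trans (sym (⌊⌋⁺ (trans (ℓ≡φ u) (trans (cong φ (classOf-resp uπv)) (sym (ℓ≡φ v)))))) ℓu=ℓv) λ ()
    ... | false | true = contradiction (trans (sym (classOf-related (injective _ _ (trans (sym (ℓ≡φ u)) (trans (==⇒≡ ℓu=ℓv) (ℓ≡φ v)))))) uπv) λ ()

  -- A colouring whose kernel is π is the same thing as an injective colouring of the blocks of π.
  kernel-colourings-count : ∑[ ℓ ∈ allFuns (allFin k) N ] ⟦ kernelTest ℓ ⟧ ≡ m̃-coeff (blockWeights G π) α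
  kernel-colourings-count = begin
    ∑[ ℓ ∈ allFuns (allFin k) N ] ⟦ kernelTest ℓ ⟧
      ≡⟨ count-bijection (allFuns-isEnumeration _==_ (allFin-isEnumeration k) N)
                         (allFuns-isEnumeration _==_ (allFin-isEnumeration k) classCount)
                         (λ ℓ j → ℓ (rep j)) (λ φ v → φ (classOf v)) kernelTest placementTest
                         (λ ℓ φ → mk⇔ (kernel⇒placement ℓ φ) (placement⇒kernel ℓ φ)) ⟩
    ∑[ φ ∈ allFuns (allFin k) classCount ] ⟦ placementTest φ ⟧
      ≡⟨ injective-placements-count classCount k W (lookup α) W-positive ⟩
    m̃-coeff (tabulate W) (tabulate (lookup α))
      ≡⟨ cong₂ m̃-coeff (trans (sym (map-tabulate rep blockWeight)) (cong (map blockWeight) (tabulate-lookup (classReps π))))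
                       (tabulate-lookup α) ⟩
    m̃-coeff (blockWeights G π) α ∎
    where open ≡-Reasoning

colours : (k : ℕ) → List (Fin k × Bool)
colours k = allPairs (allFin k) bools

colourEq : {k : ℕ} → Fin k × Bool → Fin k × Bool → Bool
colourEq = pairEq _==_ _==ᵇ_

colouringCount : WGraph → List ℕ → ℕ
colouringCount G α =
  length (filter (λ κ → proper G colourEq κ ∧ hasMonomial G proj₁ κ (lookup α)) (allFuns (colours (length α)) (n G)))

colourEq⇒≡ : {k : ℕ} {x y : Fin k × Bool} → colourEq x y ≡ true → x ≡ y
colourEq⇒≡ {x = i , b} h = cong₂ _,_ (==⇒≡ (∧⁻ˡ h)) (==ᵇ⇒≡ (∧⁻ʳ {i == _} h))

colourEq-refl : {k : ℕ} (x : Fin k × Bool) → colourEq x x ≡ true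
colourEq-refl (i , b) = ∧⁺ (==-refl i) (==ᵇ-refl b)

module ColouringCount (G : WGraph) (pos : PositiveWeights G) (α : List ℕ) where

  private
    N = n G
    k = length α
    Lℓ = allFuns (allFin k) N
    Lb = allFuns bools N

  properPair : (Fin N → Fin k) → (Fin N → Bool) → Bool
  properPair ℓ b = all (λ e → not (kernel ℓ (proj₁ e) (proj₂ e) ∧ (b (proj₁ e) ==ᵇ b (proj₂ e)))) (edges G)

  pairTest : (Fin N → Fin k) × (Fin N → Bool) → Bool
  pairTest (ℓ , b) = properPair ℓ b ∧ hasMonomialᵏ G α ℓ

  colourTest : (Fin N → Fin k × Bool) → Bool
  colourTest κ = proper G colourEq κ ∧ hasMonomial G proj₁ κ (lookup α)

  colourTest≡pairTest : ∀ κ ℓ b → (∀ v → κ v ≡ (ℓ v , b v)) → colourTest κ ≡ pairTest (ℓ , b)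
  colourTest≡pairTest κ ℓ b κ≡ = cong₂ _∧_
    (all-cong (edges G) λ { (a , a′) _ → cong (λ (x , y) → not (colourEq x y)) (cong₂ _,_ (κ≡ a) (κ≡ a′)) })
    (all-allFin-cong λ i → cong (_≡ᵇ lookup α i)
      (∑-cong (allFin N) λ v → cong (λ c → if proj₁ c == i then weight G v else 0) (κ≡ v)))

  colour⇒pair : ∀ κ y → pairEq (pointwiseEq _==_) (pointwiseEq _==ᵇ_) y (proj₁ ∘ κ , proj₂ ∘ κ) ∧ colourTest κ ≡ true →
                pointwiseEq colourEq κ (λ v → proj₁ y v , proj₂ y v) ∧ pairTest y ≡ true
  colour⇒pair κ (ℓ , b) h = ∧⁺ (pointwiseEq⁺ colourEq λ v → subst (λ c → colourEq (κ v) c ≡ true) (κ≡ v) (colourEq-refl (κ v)))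
                               (trans (sym (colourTest≡pairTest κ ℓ b κ≡)) (∧⁻ʳ {pairEq (pointwiseEq _==_) (pointwiseEq _==ᵇ_) (ℓ , b) _} h))
    where
    κ≡ : ∀ v → κ v ≡ (ℓ v , b v)
    κ≡ v = cong₂ _,_ (sym (==⇒≡ (pointwiseEq⁻ _==_ (∧⁻ˡ (∧⁻ˡ h)) v)))
                     (sym (==ᵇ⇒≡ (pointwiseEq⁻ _==ᵇ_ (∧⁻ʳ {pointwiseEq _==_ ℓ (proj₁ ∘ κ)} (∧⁻ˡ h)) v)))

  pair⇒colour : ∀ κ y → pointwiseEq colourEq κ (λ v → proj₁ y v , proj₂ y v) ∧ pairTest y ≡ true →
                pairEq (pointwiseEq _==_) (pointwiseEq _==ᵇ_) y (proj₁ ∘ κ , proj₂ ∘ κ) ∧ colourTest κ ≡ true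
  pair⇒colour κ (ℓ , b) h = ∧⁺ (∧⁺ (pointwiseEq⁺ _==_ λ v → subst (λ c → ℓ v == proj₁ c ≡ true) (sym (κ≡ v)) (==-refl (ℓ v)))
                                   (pointwiseEq⁺ _==ᵇ_ λ v → subst (λ c → b v ==ᵇ proj₂ c ≡ true) (sym (κ≡ v)) (==ᵇ-refl (b v))))
                               (trans (colourTest≡pairTest κ ℓ b κ≡) (∧⁻ʳ {pointwiseEq colourEq κ _} h))
    where
    κ≡ : ∀ v → κ v ≡ (ℓ v , b v)
    κ≡ v = colourEq⇒≡ (pointwiseEq⁻ colourEq (∧⁻ˡ h) v)

  splitting-colours : colouringCount G α ≡ ∑[ ℓ ∈ Lℓ ] ∑[ b ∈ Lb ] ⟦ pairTest (ℓ , b) ⟧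
  splitting-colours = begin
    colouringCount G α
      ≡⟨ length-filter colourTest (allFuns (colours k) N) ⟩
    ∑[ κ ∈ allFuns (colours k) N ] ⟦ colourTest κ ⟧
      ≡⟨ count-bijection (allFuns-isEnumeration colourEq (allPairs-isEnumeration (allFin-isEnumeration k) bools-isEnumeration) N)
                         (allPairs-isEnumeration (allFuns-isEnumeration _==_ (allFin-isEnumeration k) N)
                                                 (allFuns-isEnumeration _==ᵇ_ bools-isEnumeration N))
                         (λ κ → proj₁ ∘ κ , proj₂ ∘ κ) (λ (ℓ , b) v → ℓ v , b v) colourTest pairTest
                         (λ κ y → mk⇔ (colour⇒pair κ y) (pair⇒colour κ y)) ⟩
    ∑[ y ∈ allPairs Lℓ Lb ] ⟦ pairTest y ⟧
      ≡⟨ ∑-concatMap _ Lℓ _ ⟩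
    ∑[ ℓ ∈ Lℓ ] ∑ (map (ℓ ,_) Lb) (λ y → ⟦ pairTest y ⟧)
      ≡⟨ ∑-cong Lℓ (λ ℓ → ∑-map _ Lb _) ⟩
    ∑[ ℓ ∈ Lℓ ] ∑[ b ∈ Lb ] ⟦ pairTest (ℓ , b) ⟧ ∎
    where open ≡-Reasoning

  private
    SP = setPartitions N

  -- Each ℓ contributes to the single set partition equal to its kernel.
  grouping-by-kernel : ∑[ ℓ ∈ Lℓ ] ∑[ b ∈ Lb ] ⟦ pairTest (ℓ , b) ⟧ ≡
                       ∑[ π ∈ SP ] ∑[ ℓ ∈ Lℓ ] (⟦ relEq π (kernel ℓ) ⟧ * ∑[ b ∈ Lb ] ⟦ pairTest (ℓ , b) ⟧)
  grouping-by-kernel = trans (∑-cong Lℓ insert-partition) (∑-comm Lℓ SP _)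
    where
    insert-partition : ∀ ℓ → ∑[ b ∈ Lb ] ⟦ pairTest (ℓ , b) ⟧ ≡
                             ∑[ π ∈ SP ] (⟦ relEq π (kernel ℓ) ⟧ * ∑[ b ∈ Lb ] ⟦ pairTest (ℓ , b) ⟧)
    insert-partition ℓ = begin
      ∑[ b ∈ Lb ] ⟦ pairTest (ℓ , b) ⟧
        ≡⟨ sym (*-identityˡ _) ⟩
      1 * ∑[ b ∈ Lb ] ⟦ pairTest (ℓ , b) ⟧
        ≡⟨ cong (_* ∑[ b ∈ Lb ] ⟦ pairTest (ℓ , b) ⟧) (sym (setPartitions-unique (kernel-isEquivalence ℓ))) ⟩
      ∑[ π ∈ SP ] ⟦ relEq π (kernel ℓ) ⟧ * ∑[ b ∈ Lb ] ⟦ pairTest (ℓ , b) ⟧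
        ≡⟨ sym (*-distribʳ-∑ _ SP _) ⟩
      ∑[ π ∈ SP ] (⟦ relEq π (kernel ℓ) ⟧ * ∑[ b ∈ Lb ] ⟦ pairTest (ℓ , b) ⟧) ∎
      where open ≡-Reasoning

  partition-term : ∀ {π} → π ∈ SP →
    ∑[ ℓ ∈ Lℓ ] (⟦ relEq π (kernel ℓ) ⟧ * ∑[ b ∈ Lb ] ⟦ pairTest (ℓ , b) ⟧) ≡
    (if allComponentsBipartite G π then 2 ^ length (components G π) * m̃-coeff (blockWeights G π) α else 0)
  partition-term {π} π∈ = begin
    ∑[ ℓ ∈ Lℓ ] (⟦ relEq π (kernel ℓ) ⟧ * ∑[ b ∈ Lb ] ⟦ pairTest (ℓ , b) ⟧)
      ≡⟨ ∑-cong Lℓ factor ⟩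
    ∑[ ℓ ∈ Lℓ ] (⟦ relEq π (kernel ℓ) ∧ hasMonomialᵏ G α ℓ ⟧ * ∑[ b ∈ Lb ] ⟦ properOnBlocks b ⟧)
      ≡⟨ *-distribʳ-∑ _ Lℓ _ ⟩
    ∑[ ℓ ∈ Lℓ ] ⟦ relEq π (kernel ℓ) ∧ hasMonomialᵏ G α ℓ ⟧ * ∑[ b ∈ Lb ] ⟦ properOnBlocks b ⟧
      ≡⟨ cong₂ _*_ (BlockColourings.kernel-colourings-count G pos E α) properOnBlocks-count ⟩
    m̃-coeff (blockWeights G π) α * (if allComponentsBipartite G π then 2 ^ length (components G π) else 0)
      ≡⟨ *-if (allComponentsBipartite G π) {2 ^ length (components G π)} {m̃-coeff (blockWeights G π) α} ⟩
    (if allComponentsBipartite G π then 2 ^ length (components G π) * m̃-coeff (blockWeights G π) α else 0) ∎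
    where
    open ≡-Reasoning
    E = setPartitions⁻ π∈
    open PartitionComponents G E using (properOnBlocks; properOnBlocks-count)
    factor : ∀ ℓ → ⟦ relEq π (kernel ℓ) ⟧ * ∑[ b ∈ Lb ] ⟦ pairTest (ℓ , b) ⟧ ≡
                   ⟦ relEq π (kernel ℓ) ∧ hasMonomialᵏ G α ℓ ⟧ * ∑[ b ∈ Lb ] ⟦ properOnBlocks b ⟧
    factor ℓ with relEq π (kernel ℓ) in π≐kernel
    ... | false = refl
    ... | true = begin
      ∑[ b ∈ Lb ] ⟦ pairTest (ℓ , b) ⟧ + 0
        ≡⟨ +-identityʳ _ ⟩
      ∑[ b ∈ Lb ] ⟦ pairTest (ℓ , b) ⟧
        ≡⟨ ∑-cong Lb (λ b → trans (cong (λ t → ⟦ t ∧ _ ⟧) (sym (blocks≡kernel b)))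
                                  (⟦∧⟧ (properOnBlocks b) (hasMonomialᵏ G α ℓ))) ⟩
      ∑[ b ∈ Lb ] (⟦ properOnBlocks b ⟧ * ⟦ hasMonomialᵏ G α ℓ ⟧)
        ≡⟨ *-distribʳ-∑ _ Lb _ ⟩
      ∑[ b ∈ Lb ] ⟦ properOnBlocks b ⟧ * ⟦ hasMonomialᵏ G α ℓ ⟧
        ≡⟨ *-comm _ ⟦ hasMonomialᵏ G α ℓ ⟧ ⟩
      ⟦ hasMonomialᵏ G α ℓ ⟧ * ∑[ b ∈ Lb ] ⟦ properOnBlocks b ⟧ ∎
      where
      blocks≡kernel : ∀ b → properOnBlocks b ≡ properPair ℓ b
      blocks≡kernel b =
        all-cong (edges G) λ { (a , a′) _ → cong (λ t → not (t ∧ (b a ==ᵇ b a′))) (relEq⁻ π≐kernel a a′) }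
    *-if : ∀ t {x y} → y * (if t then x else 0) ≡ (if t then x * y else 0)
    *-if true {x} {y} = *-comm y x
    *-if false {y = y} = *-zeroʳ y

  colouringCount≡rhs-coeff : colouringCount G α ≡ rhs-coeff G α
  colouringCount≡rhs-coeff = trans splitting-colours (trans grouping-by-kernel (∑-cong-∈ SP λ π → partition-term))

via-edgeTests : (G : WGraph) (α : List ℕ)
                (edgeTest : (Fin (n G) → Fin (length α) × Bool) → Fin (n G) × Fin (n G) → Bool)
                (monomialTest : (Fin (n G) → Fin (length α) × Bool) → Bool) →
                X[2x]-coeff G α ≡
                  length (filter (λ κ → all (edgeTest κ) (edges G) ∧ monomialTest κ) (allFuns (colours (length α)) (n G))) →
                (∀ κ {a b} → (a , b) ∈ edges G → edgeTest κ (a , b) ≡ not (colourEq (κ a) (κ b))) →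
                (∀ κ → monomialTest κ ≡ hasMonomial G proj₁ κ (lookup α)) →
                X[2x]-coeff G α ≡ colouringCount G α
via-edgeTests G α edgeTest monomialTest unfolds edges-agree monomial-agrees =
  trans unfolds (length-filter-cong (allFuns (colours (length α)) (n G))
                  λ κ → cong₂ _∧_ (all-cong (edges G) λ { (a , b) ab∈ → edges-agree κ ab∈ }) (monomial-agrees κ))

-- The label comparison inside X[2x]-coeff is local to its definition. It is recovered by unification from its
-- value on one edge between two distinct vertices; graphs with fewer vertices only compare a colour with itself.
X[2x]-coeff≡colouringCount : (G : WGraph) (α : List ℕ) → X[2x]-coeff G α ≡ colouringCount G α
X[2x]-coeff≡colouringCount G@(record { n = zero }) α = via-edgeTests G α _ _ refl (λ { _ {()} }) (λ _ → refl)
X[2x]-coeff≡colouringCount G@(record { n = suc zero }) α =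
  via-edgeTests G α edgeTest monomialTest unfolds (λ { κ {zero} {zero} _ → cong not (agrees (κ zero)) }) (λ _ → refl)
  where
  edgeTest : (Fin 1 → Fin (length α) × Bool) → Fin 1 × Fin 1 → Bool
  edgeTest = _
  monomialTest : (Fin 1 → Fin (length α) × Bool) → Bool
  monomialTest = _
  unfolds : X[2x]-coeff G α ≡
            length (filter (λ κ → all (edgeTest κ) (edges G) ∧ monomialTest κ) (allFuns (colours (length α)) 1))
  unfolds = refl
  labelEq : Bool → Bool
  labelEq = _
  on-loop : ∀ i b → edgeTest (λ _ → (i , b)) (zero , zero) ≡ not ((i == i) ∧ labelEq b)
  on-loop i b = refl
  agrees : ∀ x → (proj₁ x == proj₁ x) ∧ labelEq (proj₂ x) ≡ colourEq x x
  agrees (i , true) = refl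
  agrees (i , false) = refl
X[2x]-coeff≡colouringCount G@(record { n = suc (suc m) }) α =
  via-edgeTests G α edgeTest monomialTest unfolds (λ κ {a} {a′} _ → cong not (agrees (κ a) (κ a′))) (λ _ → refl)
  where
  edgeTest : (Fin (suc (suc m)) → Fin (length α) × Bool) → Fin (suc (suc m)) × Fin (suc (suc m)) → Bool
  edgeTest = _
  monomialTest : (Fin (suc (suc m)) → Fin (length α) × Bool) → Bool
  monomialTest = _
  unfolds : X[2x]-coeff G α ≡
            length (filter (λ κ → all (edgeTest κ) (edges G) ∧ monomialTest κ) (allFuns (colours (length α)) (suc (suc m))))
  unfolds = refl
  labelEq : Bool → Bool → Bool
  labelEq = _
  two : ∀ {C : Set} → C → C → Fin (suc (suc m)) → C
  two x y zero = x
  two x y (suc _) = y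
  on-edge : ∀ i b j c → edgeTest (two (i , b) (j , c)) (zero , suc zero) ≡ not ((i == j) ∧ labelEq b c)
  on-edge i b j c = refl
  agrees : ∀ x y → (proj₁ x == proj₁ y) ∧ labelEq (proj₂ x) (proj₂ y) ≡ colourEq x y
  agrees (i , true) (j , true) = refl
  agrees (i , true) (j , false) = refl
  agrees (i , false) (j , true) = refl
  agrees (i , false) (j , false) = refl

corollary6 : (G : WGraph) → PositiveWeights G →
    (α : List ℕ) → X[2x]-coeff G α ≡ rhs-coeff G α
corollary6 G pos α = trans (X[2x]-coeff≡colouringCount G α) (ColouringCount.colouringCount≡rhs-coeff G pos α)
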